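{- Let $\delta$ be a positive integer, $k \geq 3$ odd, and $G$ a graph of even order $n \geq 4$ with minimum degree $\delta(G) \geq \delta$. (i) If $n > 6\delta+2$ and $e(G) \geq e(K_\delta \vee (K_{n-2\delta} + \overline{K_\delta}))$, then $G$ is $\mathrm{GBC}_k$ unless $G = K_\delta \vee (K_{n-2\delta} + \overline{K_\delta})$. (ii) If $n = 6\delta+2$ and $e(G) \geq e(K_\delta \vee (K_{n-2\delta} + \overline{K_\delta}))$, then $G$ is $\mathrm{GBC}_k$ unless $G = K_\delta \vee (K_{n-2\delta} + \overline{K_\delta})$ or $G = K_{n/2} \vee \overline{K_{n/2}}$. (iii) If $n < 6\delta+2$ and $e(G) \geq e(K_{n/2} \vee \overline{K_{n/2}})$, then $G$ is $\mathrm{GBC}_k$ unless $G = K_{n/2} \vee \overline{K_{n/2}}$.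
   Context: All graphs are finite, simple, undirected and connected; $G = H$ means isomorphism. $e(G)$ is the number of edges, $\delta(G)$ the minimum degree. $K_m$ is the complete graph, $\overline{K_m}$ the edgeless graph on $m$ vertices, $+$ disjoint union, $\vee$ join. For $S \subseteq V(G)$, $G-S$ is obtained by deleting $S$; $i(G-S)$ is the number of isolated vertices of $G-S$ and $\mathrm{odd}(G-S)$ the number of nontrivial (at least 2 vertices) components of $G-S$ of odd order. Define, over all $S \subseteq V(G)$, the quantity $\phi_k(S) = k\cdot i(G-S) - k|S|$ if $k$ is even and $\phi_k(S) = \mathrm{odd}(G-S) + k\cdot i(G-S) - k|S|$ if $k$ is odd; $\mathrm{def}_k(G) = \max_{S \subseteq V(G)} \phi_k(S)$, and a set $S$ attaining this maximum is a $k$-barrier. A graph of odd order is generalized factor-critical ($\mathrm{GFC}_k$) if $\varnothing$ is its only $k$-barrier; a graph of even order is generalized bicritical ($\mathrm{GBC}_k$) if $\varnothing$ is its only $k$-barrier. -}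

module Defs where

open import Data.Bool using (Bool; true; false; _∧_; _∨_; not; if_then_else_)
open import Data.Nat using (ℕ; zero; suc; _+_; _*_; _∸_; _<_; _≤_; _%_; _<ᵇ_; _≡ᵇ_)
open import Data.Fin using (Fin; toℕ)
import Data.Fin as Fin
open import Data.Fin.Subset using (Subset; ∣_∣)
import Data.Fin.Subset
open import Data.Fin.Permutation using (Permutation′; _⟨$⟩ʳ_)
open import Data.Vec using (lookup)
open import Data.Integer using (ℤ; +_) renaming (_+_ to _ℤ+_; _-_ to _ℤ-_; _*_ to _ℤ*_; _≤_ to _ℤ≤_)
open import Data.Product using (Σ; Σ-syntax)
open import Relation.Binary.PropositionalEquality using (_≡_; refl)
open import Data.Bool.Properties using (∨-comm)
open import Relation.Nullary.Decidable using (⌊_⌋)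

record Graph (n : ℕ) : Set where
  field
    adj    : Fin n → Fin n → Bool
    sym    : ∀ i j → adj i j ≡ adj j i
    irrefl : ∀ i → adj i i ≡ false
open Graph public

count : ∀ {n} → (Fin n → Bool) → ℕ
count {zero}  f = 0
count {suc n} f = (if f Fin.zero then 1 else 0) + count (λ i → f (Fin.suc i))

anyF : ∀ {n} → (Fin n → Bool) → Bool
anyF {zero}  f = false
anyF {suc n} f = f Fin.zero ∨ anyF (λ i → f (Fin.suc i))

eqN : ℕ → ℕ → Bool
eqN zero    zero    = true
eqN zero    (suc _) = false
eqN (suc _) zero    = false
eqN (suc m) (suc n) = eqN m n

eqN-refl : ∀ m → eqN m m ≡ true
eqN-refl zero    = refl
eqN-refl (suc m) = eqN-refl m

eqN-sym : ∀ m n → eqN m n ≡ eqN n m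
eqN-sym zero    zero    = refl
eqN-sym zero    (suc _) = refl
eqN-sym (suc _) zero    = refl
eqN-sym (suc m) (suc n) = eqN-sym m n

_==_ : ∀ {n} → Fin n → Fin n → Bool
i == j = eqN (toℕ i) (toℕ j)

mkGraph : ∀ {n} → (Fin n → Fin n → Bool) → Graph n
mkGraph r = record { adj = a ; sym = s ; irrefl = ir }
  where
  a = λ i j → not (i == j) ∧ (r i j ∨ r j i)
  s : ∀ i j → a i j ≡ a j i
  s i j rewrite eqN-sym (toℕ i) (toℕ j) | ∨-comm (r i j) (r j i) = refl
  ir : ∀ i → a i i ≡ false
  ir i rewrite eqN-refl (toℕ i) = refl

deg : ∀ {n} → Graph n → Fin n → ℕ
deg G v = count (adj G v)

sumF : ∀ {n} → (Fin n → ℕ) → ℕ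
sumF {zero}  f = 0
sumF {suc n} f = f Fin.zero + sumF (λ i → f (Fin.suc i))

edges : ∀ {n} → Graph n → ℕ
edges G = sumF (λ i → count (λ j → (toℕ i <ᵇ toℕ j) ∧ adj G i j))

MinDegreeAtLeast : ∀ {n} → Graph n → ℕ → Set
MinDegreeAtLeast G d = ∀ v → d ≤ deg G v

Iso : ∀ {n} → Graph n → Graph n → Set
Iso {n} G H = Σ[ π ∈ Permutation′ n ] (∀ i j → adj G i j ≡ adj H (π ⟨$⟩ʳ i) (π ⟨$⟩ʳ j))

out : ∀ {n} → Subset n → Fin n → Bool
out S v = not (lookup S v)

reachT : ∀ {n} → Graph n → Subset n → ℕ → Fin n → Fin n → Bool
reachT G S zero    u v = (u == v) ∧ out S u
reachT G S (suc t) u v =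
  reachT G S t u v ∨ anyF (λ w → reachT G S t u w ∧ adj G w v ∧ out S v)

-- u and v lie in the same component of G - S (walks of length ≤ n suffice)
conn : ∀ {n} → Graph n → Subset n → Fin n → Fin n → Bool
conn {n} G S u v = reachT G S n u v

Connected : ∀ {n} → Graph n → Set
Connected {n} G = ∀ u v → conn G (Data.Fin.Subset.⊥) u v ≡ true

compSize : ∀ {n} → Graph n → Subset n → Fin n → ℕ
compSize G S u = count (conn G S u)

isRep : ∀ {n} → Graph n → Subset n → Fin n → Bool
isRep G S u = out S u ∧ not (anyF (λ w → (toℕ w <ᵇ toℕ u) ∧ conn G S u w))

iso# : ∀ {n} → Graph n → Subset n → ℕ
iso# G S = count (λ u → out S u ∧ (compSize G S u ≡ᵇ 1))

odd# : ∀ {n} → Graph n → Subset n → ℕ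
odd# G S = count (λ u → isRep G S u ∧ ((compSize G S u % 2) ≡ᵇ 1) ∧ (1 <ᵇ compSize G S u))

phi : ∀ {n} → ℕ → Graph n → Subset n → ℤ
phi k G S =
  if (k % 2) ≡ᵇ 0
  then (+ (k * iso# G S)) ℤ- (+ (k * ∣ S ∣))
  else ((+ odd# G S) ℤ+ (+ (k * iso# G S))) ℤ- (+ (k * ∣ S ∣))

-- S is a k-barrier: φ_k(S) = def_k(G) = max_T φ_k(T)
Barrier : ∀ {n} → ℕ → Graph n → Subset n → Set
Barrier k G S = ∀ T → phi k G T ℤ≤ phi k G S

-- GBC_k (for even order) / GFC_k (odd order): ∅ is the only k-barrier
OnlyEmptyBarrier : ∀ {n} → ℕ → Graph n → Set
OnlyEmptyBarrier k G = ∀ S → Barrier k G S → S ≡ Data.Fin.Subset.⊥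

GBC : ∀ {n} → ℕ → Graph n → Set
GBC k G = OnlyEmptyBarrier k G

-- K_d ∨ (K_{n-2d} + \bar K_d): vertices < d form K_d (joined to all),
-- vertices in [d, n-d) form K_{n-2d}, vertices ≥ n-d form \bar K_d.
coneGraph : (n d : ℕ) → Graph n
coneGraph n d = mkGraph a
  where
  inA inB : Fin n → Bool
  inA i = toℕ i <ᵇ d
  inB i = not (inA i) ∧ (toℕ i <ᵇ (n ∸ d))
  a : Fin n → Fin n → Bool
  a i j = inA i ∨ inA j ∨ (inB i ∧ inB j)

-- K_h ∨ \bar K_{n-h}: vertices < h form a clique joined to all others,
-- the remaining vertices are pairwise nonadjacent.
-- K_{n/2} ∨ \bar K_{n/2} is splitGraph n (n / 2).
splitGraph : (n h : ℕ) → Graph n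
splitGraph n h = mkGraph (λ i j → (toℕ i <ᵇ h) ∨ (toℕ j <ᵇ h))

{-# OPTIONS --safe #-}
-- Let S ≠ ∅ be a k-barrier, s = |S|, i the number of isolated vertices of G - S
-- and P the number of its other vertices. As φ(S) ≥ φ(∅) ≥ 0, ks ≤ odd(G - S) + ki.
-- Bounding the degree of each vertex by n - 1 on S, by s on isolated vertices and by
-- s + |C| - 1 on a nontrivial component C bounds 2e(G) + n. If s ≤ i, this bound is at
-- most the value W(s) of 2e + n for K_s ∨ (K_{n-2s} + K̄_s), with equality only for that
-- graph. If s > i, there are at least k(s - i) ≥ 3 odd components, each of order at
-- least max(3, d + 1 - s); they shrink every other component, and the bound drops
-- strictly below W(max(s, d)). As W is convex, on d ≤ t ≤ n/2 it peaks at t = d when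
-- n > 6d + 2, at t = n/2 when n < 6d + 2 and at both ends when n = 6d + 2, so a graph
-- with at least as many edges as the extremal one and a nonempty barrier is extremal.
module Submission where

open import Defs renaming (sym to adj-sym)
open import Data.Bool using (Bool; true; false; _∧_; _∨_; not; if_then_else_; T)
open import Data.Bool.Properties using (∧-zeroʳ; ∧-identityʳ; ∨-zeroʳ; ∨-identityʳ)
open import Data.Unit using (tt)
open import Data.Nat
open import Data.Nat.Properties
open import Data.Nat.Tactic.RingSolver using (solve-∀)
open import Data.Nat.DivMod using (m≡m%n+[m/n]*n; m*n/n≡m)
open import Data.Integer as ℤ using () renaming (+_ to ⁺_; _-_ to _ℤ-_; _≤_ to _ℤ≤_)
import Data.Integer.Properties as ℤₚ
open import Data.Fin using (Fin; toℕ; zero; suc; fromℕ<; punchOut)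
open import Data.Fin.Properties using (toℕ-injective; toℕ-fromℕ<; punchOut-injective; any?; injective⇒≤)
import Data.Fin.Properties as Fin
open import Data.Fin.Subset using (Subset; ∣_∣)
import Data.Fin.Subset as Subset
open import Data.Fin.Permutation using (Permutation′; _⟨$⟩ʳ_; permutation)
open import Data.Vec using ([]; _∷_; lookup)
open import Data.Product using (Σ-syntax; ∃; _×_; _,_; proj₁; proj₂)
open import Data.Sum using (_⊎_; inj₁; inj₂)
open import Data.Empty using (⊥; ⊥-elim)
open import Relation.Binary.PropositionalEquality
open import Relation.Nullary using (¬_; yes; no)
open import Relation.Binary.Definitions using (tri<; tri≈; tri>)
open import Function.Base using (_∘_; case_of_)
open import Function.Definitions using (Injective)

∧-true : ∀ {a b : Bool} → a ∧ b ≡ true → a ≡ true × b ≡ true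
∧-true {true} {true} _ = refl , refl

∨-true : ∀ {a b : Bool} → a ∨ b ≡ true → a ≡ true ⊎ b ≡ true
∨-true {true}  _ = inj₁ refl
∨-true {false} e = inj₂ e

∨-introˡ : ∀ {a b : Bool} → a ≡ true → a ∨ b ≡ true
∨-introˡ refl = refl

∨-introʳ : ∀ {a b : Bool} → b ≡ true → a ∨ b ≡ true
∨-introʳ {true}  _ = refl
∨-introʳ {false} e = e

∧-intro : ∀ {a b : Bool} → a ≡ true → b ≡ true → a ∧ b ≡ true
∧-intro refl refl = refl

not-true : ∀ {a : Bool} → not a ≡ true → a ≡ false
not-true {false} _ = refl

true≢false : ∀ {a : Bool} → a ≡ true → a ≡ false → ⊥
true≢false refl ()

¬true⇒false : ∀ {a : Bool} → (a ≡ true → ⊥) → a ≡ false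
¬true⇒false {false} _ = refl
¬true⇒false {true}  h = ⊥-elim (h refl)

⇔ᵇ⇒≡ : ∀ {a b : Bool} → (a ≡ true → b ≡ true) → (b ≡ true → a ≡ true) → a ≡ b
⇔ᵇ⇒≡ {false} {false} _ _ = refl
⇔ᵇ⇒≡ {false} {true}  _ g = g refl
⇔ᵇ⇒≡ {true}          f _ = sym (f refl)

≡ᵇ⇒≡′ : ∀ {m n} → (m ≡ᵇ n) ≡ true → m ≡ n
≡ᵇ⇒≡′ {m} {n} e = ≡ᵇ⇒≡ m n (subst T (sym e) tt)

<ᵇ⇒<′ : ∀ {m n} → (m <ᵇ n) ≡ true → m < n
<ᵇ⇒<′ {m} {n} e = <ᵇ⇒< m n (subst T (sym e) tt)

<⇒<ᵇ′ : ∀ {m n} → m < n → (m <ᵇ n) ≡ true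
<⇒<ᵇ′ {m} {n} m<n with m <ᵇ n | <⇒<ᵇ m<n
... | true | _ = refl

≮⇒<ᵇ-false : ∀ {m n} → ¬ m < n → (m <ᵇ n) ≡ false
≮⇒<ᵇ-false {m} {n} m≮n with m <ᵇ n in e
... | true  = ⊥-elim (m≮n (<ᵇ⇒<′ e))
... | false = refl

==⇒≡ : ∀ {n} (i j : Fin n) → (i == j) ≡ true → i ≡ j
==⇒≡ i j e = toℕ-injective (eqN⇒≡ (toℕ i) (toℕ j) e)
  where
  eqN⇒≡ : ∀ a b → eqN a b ≡ true → a ≡ b
  eqN⇒≡ zero    zero    _ = refl
  eqN⇒≡ (suc a) (suc b) e = cong suc (eqN⇒≡ a b e)

==-refl : ∀ {n} (i : Fin n) → (i == i) ≡ true
==-refl i = eqN-refl (toℕ i)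

≢⇒==-false : ∀ {n} {i j : Fin n} → i ≢ j → (i == j) ≡ false
≢⇒==-false {i = i} {j} i≢j with i == j in e
... | true  = ⊥-elim (i≢j (==⇒≡ i j e))
... | false = refl

<ᵇ-irrefl : ∀ m → (m <ᵇ m) ≡ false
<ᵇ-irrefl m = ≮⇒<ᵇ-false {m} (<-irrefl refl)

adj⇒≢ : ∀ {n} (G : Graph n) {i j} → adj G i j ≡ true → i ≢ j
adj⇒≢ G {i} a refl = true≢false a (irrefl G i)

⟦_⟧ : Bool → ℕ
⟦ b ⟧ = if b then 1 else 0

infix 4 _⊆ᵇ_
_⊆ᵇ_ : ∀ {n} → (Fin n → Bool) → (Fin n → Bool) → Set
f ⊆ᵇ g = ∀ i → f i ≡ true → g i ≡ true

sumF-cong : ∀ {n} {f g : Fin n → ℕ} → (∀ i → f i ≡ g i) → sumF f ≡ sumF g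
sumF-cong {zero}  _ = refl
sumF-cong {suc n} h = cong₂ _+_ (h zero) (sumF-cong (λ i → h (suc i)))

sumF-mono : ∀ {n} {f g : Fin n → ℕ} → (∀ i → f i ≤ g i) → sumF f ≤ sumF g
sumF-mono {zero}  _ = z≤n
sumF-mono {suc n} h = +-mono-≤ (h zero) (sumF-mono (λ i → h (suc i)))

sumF-distrib-+ : ∀ {n} (f g : Fin n → ℕ) → sumF (λ i → f i + g i) ≡ sumF f + sumF g
sumF-distrib-+ {zero}  f g = refl
sumF-distrib-+ {suc n} f g
  rewrite sumF-distrib-+ (λ i → f (suc i)) (λ i → g (suc i)) = +-exchange (f zero) (g zero) _ _
  where
  +-exchange : ∀ a b c d → (a + b) + (c + d) ≡ (a + c) + (b + d)
  +-exchange = solve-∀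

sumF-const : ∀ {n} (c : ℕ) → sumF {n} (λ _ → c) ≡ n * c
sumF-const {zero}  c = refl
sumF-const {suc n} c = cong (c +_) (sumF-const {n} c)

sumF-swap : ∀ {n m} (f : Fin n → Fin m → ℕ) →
  sumF (λ i → sumF (λ j → f i j)) ≡ sumF (λ j → sumF (λ i → f i j))
sumF-swap {zero}  {m} f = sym (trans (sumF-const {m} 0) (*-zeroʳ m))
sumF-swap {suc n} {m} f =
  trans (cong (sumF (f zero) +_) (sumF-swap (λ i → f (suc i))))
        (sym (sumF-distrib-+ (f zero) (λ j → sumF (λ i → f (suc i) j))))

sumF-≤-tight : ∀ {n} {f g : Fin n → ℕ} → (∀ i → f i ≤ g i) → sumF g ≤ sumF f → ∀ i → f i ≡ g i
sumF-≤-tight {suc n} {f} {g} f≤g sg≤sf zero = ≤-antisym (f≤g zero)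
  (+-cancelʳ-≤ _ _ _ (≤-trans sg≤sf (+-monoʳ-≤ (f zero) (sumF-mono (λ i → f≤g (suc i))))))
sumF-≤-tight {suc n} {f} {g} f≤g sg≤sf (suc i) = sumF-≤-tight (λ j → f≤g (suc j))
  (+-cancelˡ-≤ (g zero) _ _ (≤-trans sg≤sf (+-monoˡ-≤ _ (f≤g zero)))) i

count≡sumF : ∀ {n} (f : Fin n → Bool) → count f ≡ sumF (λ i → ⟦ f i ⟧)
count≡sumF {zero}  f = refl
count≡sumF {suc n} f = cong (⟦ f zero ⟧ +_) (count≡sumF (λ i → f (suc i)))

count-cong : ∀ {n} {f g : Fin n → Bool} → (∀ i → f i ≡ g i) → count f ≡ count g
count-cong {f = f} {g} h = trans (count≡sumF f) (trans (sumF-cong (λ i → cong ⟦_⟧ (h i))) (sym (count≡sumF g)))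

count-swap : ∀ {n m} (f : Fin n → Fin m → Bool) →
  sumF (λ i → count (f i)) ≡ sumF (λ j → count (λ i → f i j))
count-swap f = begin
  sumF (λ i → count (f i))                   ≡⟨ sumF-cong (λ i → count≡sumF (f i)) ⟩
  sumF (λ i → sumF (λ j → ⟦ f i j ⟧))        ≡⟨ sumF-swap (λ i j → ⟦ f i j ⟧) ⟩
  sumF (λ j → sumF (λ i → ⟦ f i j ⟧))        ≡⟨ sumF-cong (λ j → sym (count≡sumF (λ i → f i j))) ⟩
  sumF (λ j → count (λ i → f i j))           ∎
  where open ≡-Reasoning

count-true : ∀ {n} → count {n} (λ _ → true) ≡ n
count-true {zero}  = refl
count-true {suc n} = cong suc (count-true {n})

count-mono : ∀ {n} {f g : Fin n → Bool} → f ⊆ᵇ g → count f ≤ count g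
count-mono {zero} _ = z≤n
count-mono {suc n} {f} {g} f⊆g with f zero in ef | g zero in eg
... | true  | true  = s≤s (count-mono (λ i → f⊆g (suc i)))
... | false | true  = m≤n⇒m≤1+n (count-mono (λ i → f⊆g (suc i)))
... | false | false = count-mono (λ i → f⊆g (suc i))
... | true  | false = ⊥-elim (true≢false (f⊆g zero ef) eg)

count≤n : ∀ {n} (f : Fin n → Bool) → count f ≤ n
count≤n {n} f = subst (count f ≤_) (count-true {n}) (count-mono {n} {f} {λ _ → true} (λ _ _ → refl))

count-mono-< : ∀ {n} {f g : Fin n → Bool} → f ⊆ᵇ g →
  ∀ i → g i ≡ true → f i ≡ false → count f < count g
count-mono-< {suc n} {f} {g} f⊆g zero gi fi rewrite gi | fi = s≤s (count-mono (λ j → f⊆g (suc j)))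
count-mono-< {suc n} {f} {g} f⊆g (suc i) gi fi =
  ≤-trans (≤-reflexive (sym (+-suc ⟦ f zero ⟧ _)))
          (+-mono-≤ (⟦⟧-mono (f⊆g zero)) (count-mono-< (λ j → f⊆g (suc j)) i gi fi))
  where
  ⟦⟧-mono : ∀ {a b : Bool} → (a ≡ true → b ≡ true) → ⟦ a ⟧ ≤ ⟦ b ⟧
  ⟦⟧-mono {false} _ = z≤n
  ⟦⟧-mono {true}  h rewrite h refl = ≤-refl

⊆ᵇ∧count≥⇒≗ : ∀ {n} {f g : Fin n → Bool} → f ⊆ᵇ g → count g ≤ count f → ∀ i → f i ≡ g i
⊆ᵇ∧count≥⇒≗ {f = f} {g} f⊆g cg≤cf i with f i in fi
... | true = sym (f⊆g i fi)
... | false with g i in gi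
...   | false = refl
...   | true  = ⊥-elim (<⇒≱ (count-mono-< f⊆g i gi fi) cg≤cf)

count≥1⇒∃ : ∀ {n} (f : Fin n → Bool) → 1 ≤ count f → ∃ λ i → f i ≡ true
count≥1⇒∃ {suc n} f c with f zero in e
... | true  = zero , e
... | false = let (i , fi) = count≥1⇒∃ (λ i → f (suc i)) c in suc i , fi

∀false⇒count≡0 : ∀ {n} (f : Fin n → Bool) → (∀ i → f i ≡ false) → count f ≡ 0
∀false⇒count≡0 {zero}  f h = refl
∀false⇒count≡0 {suc n} f h rewrite h zero = ∀false⇒count≡0 (λ i → f (suc i)) (λ i → h (suc i))

∃⇒count≥1 : ∀ {n} (f : Fin n → Bool) i → f i ≡ true → 1 ≤ count f
∃⇒count≥1 {n} f i fi =
  subst (_< count f) (∀false⇒count≡0 {n} _ (λ _ → refl)) (count-mono-< {f = λ _ → false} (λ _ ()) i fi refl)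

count≡0⇒∀false : ∀ {n} (f : Fin n → Bool) → count f ≡ 0 → ∀ i → f i ≡ false
count≡0⇒∀false {suc n} f c i with f zero in e
count≡0⇒∀false {suc n} f c zero    | false = e
count≡0⇒∀false {suc n} f c (suc i) | false = count≡0⇒∀false (λ i → f (suc i)) c i

count-split : ∀ {n} (f g : Fin n → Bool) →
  count f ≡ count (λ i → f i ∧ g i) + count (λ i → f i ∧ not (g i))
count-split {zero} f g = refl
count-split {suc n} f g with f zero | g zero
... | true  | true  = cong suc (count-split (λ i → f (suc i)) (λ i → g (suc i)))
... | true  | false = trans (cong suc (count-split (λ i → f (suc i)) (λ i → g (suc i)))) (sym (+-suc _ _))
... | false | _     = count-split (λ i → f (suc i)) (λ i → g (suc i))

count-∨-disjoint : ∀ {n} (f g : Fin n → Bool) → (∀ i → f i ∧ g i ≡ false) →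
  count (λ i → f i ∨ g i) ≡ count f + count g
count-∨-disjoint {zero} f g _ = refl
count-∨-disjoint {suc n} f g disj with f zero | g zero | disj zero
... | true  | false | _ = cong suc (count-∨-disjoint (λ i → f (suc i)) (λ i → g (suc i)) (λ i → disj (suc i)))
... | false | true  | _ = trans (cong suc (count-∨-disjoint (λ i → f (suc i)) (λ i → g (suc i)) (λ i → disj (suc i))))
                                (sym (+-suc _ _))
... | false | false | _ = count-∨-disjoint (λ i → f (suc i)) (λ i → g (suc i)) (λ i → disj (suc i))

count-remove : ∀ {n} (v : Fin n) (f : Fin n → Bool) →
  count f ≡ count (λ j → not (v == j) ∧ f j) + ⟦ f v ⟧
count-remove {suc n} zero f with f zero
... | true  = +-comm 1 _
... | false = sym (+-identityʳ _)
count-remove {suc n} (suc v) f with f zero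
... | true  = cong suc (count-remove v (λ j → f (suc j)))
... | false = count-remove v (λ j → f (suc j))

count-≢ : ∀ {n} (v : Fin n) → count (λ j → not (v == j)) + 1 ≡ n
count-≢ v = sym (trans (sym count-true) (trans (count-remove v (λ _ → true))
  (cong (_+ 1) (count-cong (λ j → ∧-identityʳ (not (v == j)))))))

unique⇒count≤1 : ∀ {n} (f : Fin n → Bool) → (∀ i j → f i ≡ true → f j ≡ true → i ≡ j) → count f ≤ 1
unique⇒count≤1 {zero} f _ = z≤n
unique⇒count≤1 {suc n} f uniq with f zero in e
... | true  = ≤-reflexive (cong suc (∀false⇒count≡0 (λ i → f (suc i)) others))
  where
  others : ∀ i → f (suc i) ≡ false
  others i with f (suc i) in e′
  ... | true  with () ← uniq zero (suc i) e e′
  ... | false = refl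
... | false = unique⇒count≤1 (λ i → f (suc i)) (λ i j fi fj → Fin.suc-injective (uniq (suc i) (suc j) fi fj))

count-weighted : ∀ {n} (b : Fin n → Bool) (c : Fin n → ℕ) (a : ℕ) → (∀ r → b r ≡ true → a ≤ c r) →
  a * count b ≤ sumF (λ r → if b r then c r else 0)
count-weighted {zero} b c a h = ≤-reflexive (*-zeroʳ a)
count-weighted {suc n} b c a h with b zero in e
... | true  = ≤-trans (≤-reflexive (*-suc a _))
                (+-mono-≤ (h zero e) (count-weighted (λ r → b (suc r)) (λ r → c (suc r)) a (λ r → h (suc r))))
... | false = count-weighted (λ r → b (suc r)) (λ r → c (suc r)) a (λ r → h (suc r))

anyF-intro : ∀ {n} (f : Fin n → Bool) i → f i ≡ true → anyF f ≡ true
anyF-intro f zero    e rewrite e = refl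
anyF-intro f (suc i) e rewrite anyF-intro (λ j → f (suc j)) i e = ∨-zeroʳ (f zero)

anyF-elim : ∀ {n} (f : Fin n → Bool) → anyF f ≡ true → ∃ λ i → f i ≡ true
anyF-elim {suc n} f e with f zero in e0
... | true  = zero , e0
... | false = let (i , fi) = anyF-elim (λ j → f (suc j)) e in suc i , fi

anyF-cong : ∀ {n} {f g : Fin n → Bool} → (∀ i → f i ≡ g i) → anyF f ≡ anyF g
anyF-cong {zero}  _ = refl
anyF-cong {suc n} h = cong₂ _∨_ (h zero) (anyF-cong (λ i → h (suc i)))

-- Components of G - S

module Reachability {n} (G : Graph n) (S : Subset n) where

  R : ℕ → Fin n → Fin n → Bool
  R = reachT G S

  reach-ends : ∀ t u v → R t u v ≡ true → out S u ≡ true × out S v ≡ true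
  reach-ends zero u v e with ∧-true {u == v} e
  ... | u=v , ou rewrite ==⇒≡ u v u=v = ou , ou
  reach-ends (suc t) u v e with ∨-true {R t u v} e
  ... | inj₁ r = reach-ends t u v r
  ... | inj₂ r with anyF-elim _ r
  ... | w , p with ∧-true {R t u w} p
  ... | ruw , q = proj₁ (reach-ends t u w ruw) , proj₂ (∧-true {adj G w v} q)

  reach-suc : ∀ t u v → R t u v ≡ true → R (suc t) u v ≡ true
  reach-suc t u v = ∨-introˡ

  reach-mono : ∀ {t t′} → t ≤ t′ → ∀ u v → R t u v ≡ true → R t′ u v ≡ true
  reach-mono {t} {t′} t≤t′ u v r with m≤n⇒m<n∨m≡n t≤t′
  ... | inj₂ refl = r
  reach-mono {t} {suc t′} _ u v r | inj₁ (s≤s t≤t′) = reach-suc t′ u v (reach-mono t≤t′ u v r)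

  reach-snoc : ∀ t u w v → R t u w ≡ true → adj G w v ≡ true → out S v ≡ true → R (suc t) u v ≡ true
  reach-snoc t u w v r a o = ∨-introʳ {R t u v} (anyF-intro _ w (∧-intro r (∧-intro a o)))

  reach-refl : ∀ t u → out S u ≡ true → R t u u ≡ true
  reach-refl zero    u o = ∧-intro (==-refl u) o
  reach-refl (suc t) u o = reach-suc t u u (reach-refl t u o)

  reach-last : ∀ t u v → R t u v ≡ true → u ≢ v → ∃ λ x → out S x ≡ true × adj G x v ≡ true
  reach-last zero u v e u≢v = ⊥-elim (u≢v (==⇒≡ u v (proj₁ (∧-true {u == v} e))))
  reach-last (suc t) u v e u≢v with ∨-true {R t u v} e
  ... | inj₁ r = reach-last t u v r u≢v
  ... | inj₂ r with anyF-elim _ r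
  ... | w , p with ∧-true {R t u w} p
  ... | ruw , q = w , proj₂ (reach-ends t u w ruw) , proj₁ (∧-true {adj G w v} q)

  reach-cons : ∀ t v w x → out S v ≡ true → adj G v w ≡ true → R t w x ≡ true → R (suc t) v x ≡ true
  reach-cons zero v w x o a e with ∧-true {w == x} e
  ... | w=x , ow with ==⇒≡ w x w=x
  ... | refl = reach-snoc zero v v w (reach-refl zero v o) a ow
  reach-cons (suc t) v w x o a e with ∨-true {R t w x} e
  ... | inj₁ r = reach-suc (suc t) v x (reach-cons t v w x o a r)
  ... | inj₂ r with anyF-elim _ r
  ... | y , p with ∧-true {R t w y} p
  ... | rwy , q with ∧-true {adj G y x} q
  ... | ayx , ox = reach-snoc (suc t) v y x (reach-cons t v w y o a rwy) ayx ox

  reach-sym : ∀ t u v → R t u v ≡ true → R t v u ≡ true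
  reach-sym zero u v e with ∧-true {u == v} e
  ... | u=v , _ with ==⇒≡ u v u=v
  ... | refl = e
  reach-sym (suc t) u v e with ∨-true {R t u v} e
  ... | inj₁ r = reach-suc t v u (reach-sym t u v r)
  ... | inj₂ r with anyF-elim _ r
  ... | w , p with ∧-true {R t u w} p
  ... | ruw , q with ∧-true {adj G w v} q
  ... | awv , ov = reach-cons t v w u ov (trans (adj-sym G v w) awv) (reach-sym t u w ruw)

  reach-++ : ∀ a b u v w → R a u v ≡ true → R b v w ≡ true → R (b + a) u w ≡ true
  reach-++ a zero u v w e f with ∧-true {v == w} f
  ... | v=w , _ with ==⇒≡ v w v=w
  ... | refl = e
  reach-++ a (suc b) u v w e f with ∨-true {R b v w} f
  ... | inj₁ r = reach-suc (b + a) u w (reach-++ a b u v w e r)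
  ... | inj₂ r with anyF-elim _ r
  ... | y , p with ∧-true {R b v y} p
  ... | rvy , q with ∧-true {adj G y w} q
  ... | ayw , ow = reach-snoc (b + a) u y w (reach-++ a b u v y e rvy) ayw ow

  -- The sets R t u grow strictly until they stop growing for good, and they
  -- cannot grow n + 1 times, so walks of length n reach everything.
  module _ (u : Fin n) where
    Stable : ℕ → Set
    Stable t = ∀ v → R (suc t) u v ≡ R t u v

    stable-suc : ∀ t → Stable t → Stable (suc t)
    stable-suc t st v = cong₂ _∨_ (st v) (anyF-cong (λ w → cong (_∧ (adj G w v ∧ out S v)) (st w)))

    stable-+ : ∀ t → Stable t → ∀ m v → R (m + t) u v ≡ R t u v
    stable-+ t st zero    v = refl
    stable-+ t st (suc m) v = trans (stable-suc-+ m v) (stable-+ t st m v)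
      where
      stable-suc-+ : ∀ m → Stable (m + t)
      stable-suc-+ zero    = st
      stable-suc-+ (suc m) = stable-suc (m + t) (stable-suc-+ m)

    out-false⇒reach-false : out S u ≡ false → ∀ t v → R t u v ≡ false
    out-false⇒reach-false o t v with R t u v in e
    ... | true  = ⊥-elim (true≢false (proj₁ (reach-ends t u v e)) o)
    ... | false = refl

    stable-or-grown : ∀ t → Stable t ⊎ t < count (R t u)
    stable-or-grown zero = start (out S u) refl
      where
      start : ∀ b → out S u ≡ b → Stable zero ⊎ 0 < count (R zero u)
      start true  o = inj₂ (∃⇒count≥1 (R zero u) u (reach-refl zero u o))
      start false o = inj₁ (λ v → trans (out-false⇒reach-false o 1 v) (sym (out-false⇒reach-false o 0 v)))
    stable-or-grown (suc t) with stable-or-grown t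
    ... | inj₁ st = inj₁ (stable-suc t st)
    ... | inj₂ grown with count (R (suc t) u) ≤? count (R t u)
    ... | yes no-growth = inj₁ (stable-suc t (λ v → sym (⊆ᵇ∧count≥⇒≗ (λ w → reach-suc t u w) no-growth v)))
    ... | no growth     = inj₂ (≤-trans (s≤s grown) (≰⇒> growth))

    stable-at-n : Stable n
    stable-at-n with stable-or-grown n
    ... | inj₁ st    = st
    ... | inj₂ grown = ⊥-elim (<⇒≱ grown (count≤n (R n u)))

  conn-ends : ∀ u v → conn G S u v ≡ true → out S u ≡ true × out S v ≡ true
  conn-ends = reach-ends n

  conn-refl : ∀ u → out S u ≡ true → conn G S u u ≡ true
  conn-refl = reach-refl n

  conn-sym : ∀ u v → conn G S u v ≡ true → conn G S v u ≡ true
  conn-sym = reach-sym n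

  conn-trans : ∀ u v w → conn G S u v ≡ true → conn G S v w ≡ true → conn G S u w ≡ true
  conn-trans u v w e f = trans (sym (stable-+ u n (stable-at-n u) n w)) (reach-++ n n u v w e f)

  conn-adj : ∀ u v → out S u ≡ true → out S v ≡ true → adj G u v ≡ true → conn G S u v ≡ true
  conn-adj u v ou ov a = reach-mono (1≤n u) u v (reach-snoc zero u u v (reach-refl zero u ou) a ov)
    where
    1≤n : Fin n → 1 ≤ n
    1≤n zero    = s≤s z≤n
    1≤n (suc _) = s≤s z≤n

  conn-last : ∀ u v → conn G S u v ≡ true → u ≢ v → ∃ λ x → out S x ≡ true × adj G x v ≡ true
  conn-last = reach-last n

module Components {n} (G : Graph n) (S : Subset n) where
  open Reachability G S public

  inS : Fin n → Bool
  inS = lookup S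

  s : ℕ
  s = count inS

  size : Fin n → ℕ
  size = compSize G S

  isolated : Fin n → Bool
  isolated u = out S u ∧ (size u ≡ᵇ 1)

  oddRep : Fin n → Bool
  oddRep u = isRep G S u ∧ ((size u % 2) ≡ᵇ 1) ∧ (1 <ᵇ size u)

  nontrivial : Fin n → Bool
  nontrivial u = out S u ∧ not (isolated u)

  count-out+s : count (out S) + s ≡ n
  count-out+s = trans (+-comm _ s) (trans (sym (count-split (λ _ → true) inS)) count-true)

  count-out : count (out S) ≡ count isolated + count nontrivial
  count-out = trans (count-split (out S) isolated) (cong (_+ count nontrivial) (count-cong out∧isolated))
    where
    out∧isolated : ∀ w → out S w ∧ isolated w ≡ isolated w
    out∧isolated w with out S w
    ... | true  = refl
    ... | false = refl

  size≡ : ∀ v → out S v ≡ true → size v ≡ count (λ j → not (v == j) ∧ conn G S v j) + 1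
  size≡ v o = trans (count-remove v (conn G S v))
                    (cong (λ b → count (λ j → not (v == j) ∧ conn G S v j) + ⟦ b ⟧) (conn-refl v o))

  possibleNbr : Fin n → Fin n → Bool
  possibleNbr v j = inS j ∨ (not (v == j) ∧ conn G S v j)

  adj⊆possibleNbr : ∀ v → out S v ≡ true → adj G v ⊆ᵇ possibleNbr v
  adj⊆possibleNbr v o j a with inS j in j∈S
  ... | true  = refl
  ... | false rewrite ≢⇒==-false (adj⇒≢ G a) = conn-adj v j o (cong not j∈S) a

  count-possibleNbr : ∀ v → out S v ≡ true → count (possibleNbr v) + 1 ≡ s + size v
  count-possibleNbr v o =
    trans (cong (_+ 1) (count-∨-disjoint inS _ disjoint)) (trans (+-assoc s _ 1) (cong (s +_) (sym (size≡ v o))))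
    where
    disjoint : ∀ j → inS j ∧ (not (v == j) ∧ conn G S v j) ≡ false
    disjoint j with inS j in j∈S | conn G S v j in c
    ... | false | _     = refl
    ... | true  | false = ∧-zeroʳ _
    ... | true  | true  = ⊥-elim (true≢false (proj₂ (conn-ends v j c)) (cong not j∈S))

  adj⊆≢ : ∀ v → adj G v ⊆ᵇ (λ j → not (v == j))
  adj⊆≢ v j a rewrite ≢⇒==-false (adj⇒≢ G a) = refl

  deg+1≤n : ∀ v → deg G v + 1 ≤ n
  deg+1≤n v = ≤-trans (+-monoˡ-≤ 1 (count-mono (adj⊆≢ v))) (≤-reflexive (count-≢ v))

  deg+1≤s+size : ∀ v → out S v ≡ true → deg G v + 1 ≤ s + size v
  deg+1≤s+size v o =
    ≤-trans (+-monoˡ-≤ 1 (count-mono (adj⊆possibleNbr v o))) (≤-reflexive (count-possibleNbr v o))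

  isolated⇒out : ∀ w → isolated w ≡ true → out S w ≡ true
  isolated⇒out w e = proj₁ (∧-true {out S w} e)

  isolated⇒size≡1 : ∀ w → isolated w ≡ true → size w ≡ 1
  isolated⇒size≡1 w e = ≡ᵇ⇒≡′ (proj₂ (∧-true {out S w} e))

  adj-isolated⊆S : ∀ w → isolated w ≡ true → adj G w ⊆ᵇ inS
  adj-isolated⊆S w e x a with inS x in x∈S
  ... | true  = refl
  ... | false = ⊥-elim (<-irrefl refl (subst (1 <_) (isolated⇒size≡1 w e) size≥2))
    where
    size≥2 : 2 ≤ size w
    size≥2 = ≤-trans (+-monoˡ-≤ 1 (∃⇒count≥1 _ x (∧-intro (cong not (≢⇒==-false (adj⇒≢ G a)))
               (conn-adj w x (isolated⇒out w e) (cong not x∈S) a))))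
             (≤-reflexive (sym (size≡ w (isolated⇒out w e))))

  deg-isolated≤s : ∀ w → isolated w ≡ true → deg G w ≤ s
  deg-isolated≤s w e = count-mono (adj-isolated⊆S w e)

  conn-isolated : ∀ v w → isolated w ≡ true → conn G S v w ≡ true → v ≡ w
  conn-isolated v w e c with v Fin.≟ w
  ... | yes v≡w = v≡w
  ... | no  v≢w with conn-last v w c v≢w
  ... | x , ox , a = ⊥-elim (true≢false (adj-isolated⊆S w e x (trans (adj-sym G w x) a)) (not-true ox))

  oddRep⇒isRep : ∀ r → oddRep r ≡ true → isRep G S r ≡ true
  oddRep⇒isRep r e = proj₁ (∧-true {isRep G S r} e)

  oddRep⇒out : ∀ r → oddRep r ≡ true → out S r ≡ true
  oddRep⇒out r e = proj₁ (∧-true {out S r} (oddRep⇒isRep r e))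

  oddRep⇒size≥3 : ∀ r → oddRep r ≡ true → 3 ≤ size r
  oddRep⇒size≥3 r e with ∧-true {isRep G S r} e
  ... | _ , e′ with ∧-true {(size r % 2) ≡ᵇ 1} e′
  ... | odd , >1 = odd>1⇒≥3 (size r) odd >1
    where
    odd>1⇒≥3 : ∀ c → (c % 2 ≡ᵇ 1) ≡ true → (1 <ᵇ c) ≡ true → 3 ≤ c
    odd>1⇒≥3 (suc (suc (suc c))) _ _ = s≤s (s≤s (s≤s z≤n))

  oddRep⇒¬isolated : ∀ r → oddRep r ≡ true → isolated r ≡ false
  oddRep⇒¬isolated r e with isolated r in i
  ... | false = refl
  ... | true  with s≤s () ← subst (3 ≤_) (isolated⇒size≡1 r i) (oddRep⇒size≥3 r e)

  rep-minimal : ∀ r w → isRep G S r ≡ true → conn G S r w ≡ true → ¬ toℕ w < toℕ r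
  rep-minimal r w e c lt =
    true≢false (anyF-intro _ w (∧-intro (<⇒<ᵇ′ lt) c)) (not-true (proj₂ (∧-true {out S r} e)))

  rep-unique : ∀ r₁ r₂ w → isRep G S r₁ ≡ true → isRep G S r₂ ≡ true →
               conn G S r₁ w ≡ true → conn G S r₂ w ≡ true → r₁ ≡ r₂
  rep-unique r₁ r₂ w e₁ e₂ c₁ c₂ with <-cmp (toℕ r₁) (toℕ r₂)
  ... | tri< lt _ _ = ⊥-elim (rep-minimal r₂ r₁ e₂ (conn-trans r₂ w r₁ c₂ (conn-sym r₁ w c₁)) lt)
  ... | tri≈ _ eq _ = toℕ-injective eq
  ... | tri> _ _ gt = ⊥-elim (rep-minimal r₁ r₂ e₁ (conn-trans r₁ w r₂ c₁ (conn-sym r₂ w c₂)) gt)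

  farOddRep : Fin n → Fin n → Bool
  farOddRep v r = oddRep r ∧ not (conn G S r v)

  count-oddRep≤1+far : ∀ v → count oddRep ≤ 1 + count (farOddRep v)
  count-oddRep≤1+far v = ≤-trans (≤-reflexive (count-split oddRep (λ r → conn G S r v)))
    (+-monoˡ-≤ (count (farOddRep v)) (unique⇒count≤1 _ (λ r₁ r₂ e₁ e₂ →
      let (o₁ , c₁) = ∧-true {oddRep r₁} e₁
          (o₂ , c₂) = ∧-true {oddRep r₂} e₂
      in rep-unique r₁ r₂ v (oddRep⇒isRep r₁ o₁) (oddRep⇒isRep r₂ o₂) c₁ c₂)))

  farCover : Fin n → Fin n → ℕ
  farCover v w = count (λ r → farOddRep v r ∧ conn G S r w)

  farCover≤1 : ∀ v w → farCover v w ≤ 1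
  farCover≤1 v w = unique⇒count≤1 _ (λ r₁ r₂ e₁ e₂ →
    let (b₁ , c₁) = ∧-true {farOddRep v r₁} e₁
        (b₂ , c₂) = ∧-true {farOddRep v r₂} e₂
    in rep-unique r₁ r₂ w (oddRep⇒isRep r₁ (proj₁ (∧-true {oddRep r₁} b₁)))
                          (oddRep⇒isRep r₂ (proj₁ (∧-true {oddRep r₂} b₂))) c₁ c₂)

  farCover≡0 : ∀ v w → (∀ r → farOddRep v r ≡ true → conn G S r w ≡ false) → farCover v w ≡ 0
  farCover≡0 v w h = ∀false⇒count≡0 _ (λ r → lemma r (farOddRep v r) refl)
    where
    lemma : ∀ r b → farOddRep v r ≡ b → b ∧ conn G S r w ≡ false
    lemma r true  e = h r e
    lemma r false _ = refl

  -- The component of v, the isolated vertices and the odd components other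
  -- than that of v are pairwise disjoint parts of G - S.
  disjoint-cover : ∀ v → isolated v ≡ false → ∀ w →
    ⟦ conn G S v w ⟧ + ⟦ isolated w ⟧ + farCover v w ≤ ⟦ out S w ⟧
  disjoint-cover v v-noniso w = by-out (out S w) refl
    where
    by-out : ∀ b → out S w ≡ b → ⟦ conn G S v w ⟧ + ⟦ isolated w ⟧ + farCover v w ≤ ⟦ b ⟧
    by-out false ow rewrite ¬true⇒false (λ c → true≢false (proj₂ (conn-ends v w c)) ow)
                    | ¬true⇒false (λ i → true≢false (isolated⇒out w i) ow)
                    | farCover≡0 v w (λ r _ → ¬true⇒false (λ c → true≢false (proj₂ (conn-ends r w c)) ow))
                    = z≤n
    by-out true ow = at-most-one (farCover≤1 v w) conn⇒¬isolated conn⇒noFar isolated⇒noFar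
      where
      at-most-one : ∀ {a b : Bool} {z} → z ≤ 1 → (a ≡ true → b ≡ false) →
        (a ≡ true → z ≡ 0) → (b ≡ true → z ≡ 0) → ⟦ a ⟧ + ⟦ b ⟧ + z ≤ 1
      at-most-one {true}  {true}  _   a⇒¬b _  _  = ⊥-elim (true≢false refl (a⇒¬b refl))
      at-most-one {true}  {false} _   _    a⇒0 _ rewrite a⇒0 refl = s≤s z≤n
      at-most-one {false} {true}  _   _    _  b⇒0 rewrite b⇒0 refl = s≤s z≤n
      at-most-one {false} {false} z≤1 _    _  _  = z≤1
      conn⇒¬isolated : conn G S v w ≡ true → isolated w ≡ false
      conn⇒¬isolated c = ¬true⇒false (λ iw →
        true≢false (subst (λ x → isolated x ≡ true) (sym (conn-isolated v w iw c)) iw) v-noniso)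
      conn⇒noFar : conn G S v w ≡ true → farCover v w ≡ 0
      conn⇒noFar c = farCover≡0 v w (λ r far → ¬true⇒false (λ crw →
        true≢false (conn-trans r w v crw (conn-sym v w c)) (not-true (proj₂ (∧-true {oddRep r} far)))))
      isolated⇒noFar : isolated w ≡ true → farCover v w ≡ 0
      isolated⇒noFar iw = farCover≡0 v w (λ r far → ¬true⇒false (λ crw →
        true≢false (subst (λ x → isolated x ≡ true) (sym (conn-isolated r w iw crw)) iw)
                   (oddRep⇒¬isolated r (proj₁ (∧-true {oddRep r} far)))))

  size+isolated+far≤out : ∀ v → isolated v ≡ false → (a : ℕ) → (∀ r → oddRep r ≡ true → a ≤ size r) →
    size v + count isolated + a * count (farOddRep v) ≤ count (out S)
  size+isolated+far≤out v v-noniso a a≤size = begin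
    size v + count isolated + a * count (farOddRep v)
      ≤⟨ +-monoʳ-≤ (size v + count isolated)
           (count-weighted (farOddRep v) size a (λ r e → a≤size r (proj₁ (∧-true {oddRep r} e)))) ⟩
    size v + count isolated + sumF (λ r → if farOddRep v r then size r else 0)
      ≡⟨ sym cover-sum ⟩
    sumF (λ w → ⟦ conn G S v w ⟧ + ⟦ isolated w ⟧ + farCover v w)
      ≤⟨ sumF-mono (disjoint-cover v v-noniso) ⟩
    sumF (λ w → ⟦ out S w ⟧)
      ≡⟨ sym (count≡sumF (out S)) ⟩
    count (out S) ∎
    where
    open ≤-Reasoning
    farCover-sum : sumF (farCover v) ≡ sumF (λ r → if farOddRep v r then size r else 0)
    farCover-sum = trans (sym (count-swap (λ r w → farOddRep v r ∧ conn G S r w)))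
                         (sumF-cong (λ r → by-cases r (farOddRep v r) refl))
      where
      by-cases : ∀ r b → farOddRep v r ≡ b →
        count (λ w → farOddRep v r ∧ conn G S r w) ≡ (if farOddRep v r then size r else 0)
      by-cases r true  e rewrite e = refl
      by-cases r false e rewrite e = ∀false⇒count≡0 {n} (λ _ → false) (λ _ → refl)
    cover-sum : sumF (λ w → ⟦ conn G S v w ⟧ + ⟦ isolated w ⟧ + farCover v w)
              ≡ size v + count isolated + sumF (λ r → if farOddRep v r then size r else 0)
    cover-sum = trans (sumF-distrib-+ (λ w → ⟦ conn G S v w ⟧ + ⟦ isolated w ⟧) (farCover v))
      (cong₂ _+_ (trans (sumF-distrib-+ (λ w → ⟦ conn G S v w ⟧) (λ w → ⟦ isolated w ⟧))
                        (cong₂ _+_ (sym (count≡sumF (conn G S v))) (sym (count≡sumF isolated))))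
                 farCover-sum)

closedDegSum : ∀ {n} → Graph n → ℕ
closedDegSum G = sumF (λ v → deg G v + 1)

handshake : ∀ {n} (G : Graph n) → sumF (deg G) ≡ edges G + edges G
handshake {n} G = begin
  sumF (λ i → count (adj G i))
    ≡⟨ sumF-cong (λ i → trans (count-cong (split i)) (count-∨-disjoint _ _ (disjoint i))) ⟩
  sumF (λ i → count (forward i) + count (backward i))
    ≡⟨ sumF-distrib-+ (λ i → count (forward i)) (λ i → count (backward i)) ⟩
  edges G + sumF (λ i → count (backward i))
    ≡⟨ cong (edges G +_) (count-swap backward) ⟩
  edges G + sumF (λ j → count (λ i → backward i j))
    ≡⟨ cong (edges G +_) (sumF-cong (λ j → count-cong (λ i → cong ((toℕ j <ᵇ toℕ i) ∧_) (adj-sym G i j)))) ⟩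
  edges G + edges G
    ∎
  where
  open ≡-Reasoning
  forward backward : Fin n → Fin n → Bool
  forward  i j = (toℕ i <ᵇ toℕ j) ∧ adj G i j
  backward i j = (toℕ j <ᵇ toℕ i) ∧ adj G i j
  split : ∀ i j → adj G i j ≡ forward i j ∨ backward i j
  split i j with <-cmp (toℕ i) (toℕ j)
  ... | tri< lt _ gt rewrite <⇒<ᵇ′ lt | ≮⇒<ᵇ-false gt = sym (∨-identityʳ _)
  ... | tri> lt _ gt rewrite <⇒<ᵇ′ gt | ≮⇒<ᵇ-false lt = refl
  ... | tri≈ _ eq _ with toℕ-injective eq
  ... | refl rewrite irrefl G i | ∧-zeroʳ (toℕ i <ᵇ toℕ i) = refl
  disjoint : ∀ i j → forward i j ∧ backward i j ≡ false
  disjoint i j with toℕ i <ᵇ toℕ j in lt | toℕ j <ᵇ toℕ i in gt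
  ... | true  | true  = ⊥-elim (<-asym (<ᵇ⇒<′ {toℕ i} lt) (<ᵇ⇒<′ {toℕ j} gt))
  ... | true  | false = ∧-zeroʳ (adj G i j)
  ... | false | _     = refl

closedDegSum≡ : ∀ {n} (G : Graph n) → closedDegSum G ≡ (edges G + edges G) + n
closedDegSum≡ {n} G =
  trans (sumF-distrib-+ (deg G) (λ _ → 1)) (cong₂ _+_ (handshake G) (trans (sumF-const {n} 1) (*-identityʳ n)))

closedDegSum-mono : ∀ {n} (G H : Graph n) → edges H ≤ edges G → closedDegSum H ≤ closedDegSum G
closedDegSum-mono {n} G H e≤e = begin
  closedDegSum H             ≡⟨ closedDegSum≡ H ⟩
  edges H + edges H + n      ≤⟨ +-monoˡ-≤ n (+-mono-≤ e≤e e≤e) ⟩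
  edges G + edges G + n      ≡⟨ closedDegSum≡ G ⟨
  closedDegSum G             ∎
  where open ≤-Reasoning

sumF-by-class : ∀ {n} (A C : Fin n → Bool) (x y z : ℕ) → (∀ v → A v ∧ C v ≡ false) →
  sumF (λ v → if A v then x else (if C v then y else z)) ≡
  count A * x + count C * y + count (λ v → not (A v) ∧ not (C v)) * z
sumF-by-class {zero} A C x y z _ = refl
sumF-by-class {suc n} A C x y z disj =
  step (A zero) (C zero) (disj zero) _ (sumF-by-class (λ v → A (suc v)) (λ v → C (suc v)) x y z (λ v → disj (suc v)))
  where
  a : ℕ
  a = count (λ v → A (suc v))
  c : ℕ
  c = count (λ v → C (suc v))
  b : ℕ
  b = count (λ v → not (A (suc v)) ∧ not (C (suc v)))
  step : ∀ α γ → α ∧ γ ≡ false → ∀ R → R ≡ a * x + c * y + b * z →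
    (if α then x else (if γ then y else z)) + R ≡ (⟦ α ⟧ + a) * x + (⟦ γ ⟧ + c) * y + (⟦ not α ∧ not γ ⟧ + b) * z
  step true  false _ _ refl = identity x a c y b z
    where
    identity : ∀ x a c y b z → x + (a * x + c * y + b * z) ≡ (1 + a) * x + (0 + c) * y + (0 + b) * z
    identity = solve-∀
  step false true  _ _ refl = identity x a c y b z
    where
    identity : ∀ x a c y b z → y + (a * x + c * y + b * z) ≡ (0 + a) * x + (1 + c) * y + (0 + b) * z
    identity = solve-∀
  step false false _ _ refl = identity x a c y b z
    where
    identity : ∀ x a c y b z → z + (a * x + c * y + b * z) ≡ (0 + a) * x + (0 + c) * y + (1 + b) * z
    identity = solve-∀

-- Arithmetic of the degree bounds

-- 2e + n for K_t ∨ (K_{2y} + K̄_t), see cone-closedDegSum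
coneDegSum : ℕ → ℕ → ℕ
coneDegSum t y = (t + (y + y)) * (t + (y + y)) + (t * t + t * t) + t

-- Σ (deg v + 1) when the s vertices of S have closed degree ≤ s + i + P, the
-- i isolated vertices ≤ s + 1 and the P others ≤ s + Z (Z bounding their component orders)
degBound : ℕ → ℕ → ℕ → ℕ → ℕ
degBound s i P Z = s * (s + i + P) + i * (s + 1) + P * (s + Z)

half : ∀ x z h → x + x + z ≡ h + h → ∃ λ y → x + y ≡ h × z ≡ y + y
half x z h e with x ≤? h
... | no  x≰h = ⊥-elim (<-irrefl refl (begin-strict
      h + h         <⟨ +-mono-< (≰⇒> x≰h) (≰⇒> x≰h) ⟩
      x + x         ≤⟨ m≤m+n (x + x) z ⟩
      x + x + z     ≡⟨ e ⟩
      h + h         ∎))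
  where open ≤-Reasoning
... | yes x≤h = h ∸ x , m+[n∸m]≡n x≤h , +-cancelˡ-≡ (x + x) _ _ (begin
      x + x + z                     ≡⟨ e ⟩
      h + h                         ≡⟨ cong (λ u → u + u) (m+[n∸m]≡n x≤h) ⟨
      (x + (h ∸ x)) + (x + (h ∸ x)) ≡⟨ +-exchange x (h ∸ x) ⟩
      x + x + ((h ∸ x) + (h ∸ x))   ∎)
  where
  open ≡-Reasoning
  +-exchange : ∀ x y → (x + y) + (x + y) ≡ x + x + (y + y)
  +-exchange = solve-∀

degBound-excess : ∀ s j P y → P + j ≡ y + y →
  degBound s (s + j) P P + j * (j + (P + P)) ≡ coneDegSum s y + j
degBound-excess s j P y e rewrite sym e = identity s j P
  where
  identity : ∀ s j P → s * (s + (s + j) + P) + (s + j) * (s + 1) + P * (s + P) + j * (j + (P + P))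
                     ≡ (s + (P + j)) * (s + (P + j)) + (s * s + s * s) + s + j
  identity = solve-∀

degBound≤coneDegSum : ∀ s j P y → P + j ≡ y + y → degBound s (s + j) P P ≤ coneDegSum s y
degBound≤coneDegSum s j P y e = +-cancelʳ-≤ j _ _ (begin
  degBound s (s + j) P P + j                   ≤⟨ +-monoʳ-≤ (degBound s (s + j) P P) (j≤j*[j+2P] j) ⟩
  degBound s (s + j) P P + j * (j + (P + P))   ≡⟨ degBound-excess s j P y e ⟩
  coneDegSum s y + j                           ∎)
  where
  open ≤-Reasoning
  j≤j*[j+2P] : ∀ j → j ≤ j * (j + (P + P))
  j≤j*[j+2P] zero    = z≤n
  j≤j*[j+2P] (suc j) = m≤m*n (suc j) (suc j + (P + P))

coneDegSum≤degBound⇒j≡0 : ∀ s j P y → P + j ≡ y + y → coneDegSum s y ≤ degBound s (s + j) P P → j ≡ 0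
coneDegSum≤degBound⇒j≡0 s zero    P y e le = refl
coneDegSum≤degBound⇒j≡0 s (suc j) P y e le = ⊥-elim (too-small j P e (*-cancelˡ-≤ (suc j) (begin
  suc j * (suc j + (P + P))        ≤⟨ +-cancelˡ-≤ (degBound s (s + suc j) P P) _ _ (begin
      degBound s (s + suc j) P P + suc j * (suc j + (P + P))   ≡⟨ degBound-excess s (suc j) P y e ⟩
      coneDegSum s y + suc j                                   ≤⟨ +-monoˡ-≤ (suc j) le ⟩
      degBound s (s + suc j) P P + suc j                       ∎) ⟩
  suc j                            ≡⟨ *-identityʳ (suc j) ⟨
  suc j * 1                        ∎)))
  where
  open ≤-Reasoning
  odd≢even : ∀ y → 1 ≢ y + y
  odd≢even (suc y) e with () ← trans (cong pred e) (+-suc y y)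
  too-small : ∀ j P → P + suc j ≡ y + y → suc j + (P + P) ≤ 1 → ⊥
  too-small zero    zero    e _         = odd≢even y e
  too-small zero    (suc P) _ (s≤s ())
  too-small (suc j) P       _ (s≤s ())

degBound<coneDegSum : ∀ i j y M → M * (j + (y + y)) + 1 ≤ (y + y) * (y + y) →
  degBound (i + j) i (j + (y + y)) M < coneDegSum (i + j) y
degBound<coneDegSum i j y M small = +-cancelʳ-≤ (M * P) _ _ (begin
  suc (degBound (i + j) i P M) + M * P    ≡⟨ +-suc-comm (degBound (i + j) i P M) (M * P) ⟩
  degBound (i + j) i P M + (M * P + 1)    ≤⟨ +-monoʳ-≤ (degBound (i + j) i P M) (≤-trans small (m≤m+n _ j)) ⟩
  degBound (i + j) i P M + ((y + y) * (y + y) + j) ≡⟨ identity i j y M ⟨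
  coneDegSum (i + j) y + M * P           ∎)
  where
  open ≤-Reasoning
  P : ℕ
  P = j + (y + y)
  +-suc-comm : ∀ b m → suc b + m ≡ b + (m + 1)
  +-suc-comm = solve-∀
  identity : ∀ i j y M →
    ((i + j) + (y + y)) * ((i + j) + (y + y)) + ((i + j) * (i + j) + (i + j) * (i + j)) + (i + j) + M * (j + (y + y))
    ≡ (i + j) * ((i + j) + i + (j + (y + y))) + i * ((i + j) + 1) + (j + (y + y)) * ((i + j) + M)
      + ((y + y) * (y + y) + j)
  identity = solve-∀

degBound<coneDegSum-shifted : ∀ s′ e y M →
  let s = suc s′ ; P = s + (e + e) + (y + y) in
  M * P + (e + 1) * (3 * s′ + 2) * P ≤ P * P → degBound s 0 P M < coneDegSum (s + e) y
degBound<coneDegSum-shifted s′ e y M small = +-cancelʳ-≤ (P * P) _ _ (begin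
  suc (degBound s 0 P M) + P * P         ≡⟨ cong (_+ P * P) (+-comm 1 (degBound s 0 P M)) ⟩
  degBound s 0 P M + 1 + P * P           ≤⟨ +-monoˡ-≤ (P * P) (+-monoʳ-≤ (degBound s 0 P M) 1≤R+s) ⟩
  degBound s 0 P M + (R + s) + P * P     ≡⟨ identity s′ e y M ⟨
  coneDegSum (s + e) y + (M * P + (e + 1) * (3 * s′ + 2) * P) ≤⟨ +-monoʳ-≤ (coneDegSum (s + e) y) small ⟩
  coneDegSum (s + e) y + P * P           ∎)
  where
  open ≤-Reasoning
  s : ℕ
  s = suc s′
  P : ℕ
  P = s + (e + e) + (y + y)
  R : ℕ
  R = P * (3 * s′ * e + s′) + s * s + 4 * s * e + 3 * e * e + e
  1≤R+s : 1 ≤ R + s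
  1≤R+s = ≤-trans (s≤s z≤n) (≤-reflexive (sym (+-suc R s′)))
  identity : ∀ s′ e y M →
    let s = suc s′ ; P = s + (e + e) + (y + y) in
    (s + e + (y + y)) * (s + e + (y + y)) + ((s + e) * (s + e) + (s + e) * (s + e)) + (s + e)
      + (M * P + (e + 1) * (3 * s′ + 2) * P)
    ≡ s * (s + 0 + P) + 0 * (s + 1) + P * (s + M)
      + ((P * (3 * s′ * e + s′) + s * s + 4 * s * e + 3 * e * e + e) + s) + P * P
  identity = solve-∀

M*P+1≤[y+y]² : ∀ j y M a c → 1 ≤ j → 3 ≤ a → 3 * j ≤ c + 1 → M + a * c ≤ j + (y + y) →
  M * (j + (y + y)) + 1 ≤ (y + y) * (y + y)
M*P+1≤[y+y]² (suc j′) y M a c _ 3≤a 3j≤c+1 M+ac≤P = +-cancelˡ-≤ (P * (j + j + 1)) _ _ (begin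
  P * (j + j + 1) + (M * P + 1)             ≤⟨ +-monoʳ-≤ (P * (j + j + 1)) (+-monoʳ-≤ (M * P) 1≤X) ⟩
  P * (j + j + 1) + (M * P + X)             ≡⟨ +-assoc (P * (j + j + 1)) (M * P) X ⟨
  P * (j + j + 1) + M * P + X               ≤⟨ +-monoˡ-≤ X P*[2j+1]+M*P≤P*P ⟩
  P * P + X                                 ≡⟨ identity j y ⟩
  P * (j + j + 1) + (y + y) * (y + y)       ∎)
  where
  open ≤-Reasoning
  j : ℕ
  j = suc j′
  P : ℕ
  P = j + (y + y)
  X : ℕ
  X = j * j + j + (y + y)
  1≤X : 1 ≤ X
  1≤X = ≤-trans (s≤s z≤n) (≤-trans (m≤n+m j (j * j)) (m≤m+n (j * j + j) (y + y)))
  2j≤c : j + j ≤ c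
  2j≤c = ≤-trans (m≤m+n (j + j) j′) (+-cancelʳ-≤ 1 _ _ (≤-trans (≤-reflexive (3j≡ j′)) 3j≤c+1))
    where
    3j≡ : ∀ j′ → suc j′ + suc j′ + j′ + 1 ≡ 3 * suc j′
    3j≡ = solve-∀
  2j+1≤ac : j + j + 1 ≤ a * c
  2j+1≤ac = begin
    j + j + 1       ≤⟨ +-mono-≤ 2j≤c (≤-trans (s≤s z≤n) 2j≤c) ⟩
    c + c           ≤⟨ +-monoʳ-≤ c (m≤m+n c (c + 0)) ⟩
    3 * c           ≤⟨ *-monoˡ-≤ c 3≤a ⟩
    a * c           ∎
  P*[2j+1]+M*P≤P*P : P * (j + j + 1) + M * P ≤ P * P
  P*[2j+1]+M*P≤P*P = begin
    P * (j + j + 1) + M * P   ≤⟨ +-monoˡ-≤ (M * P) (*-monoʳ-≤ P 2j+1≤ac) ⟩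
    P * (a * c) + M * P       ≡⟨ cong (P * (a * c) +_) (*-comm M P) ⟩
    P * (a * c) + P * M       ≡⟨ *-distribˡ-+ P (a * c) M ⟨
    P * (a * c + M)           ≡⟨ cong (P *_) (+-comm (a * c) M) ⟩
    P * (M + a * c)           ≤⟨ *-monoʳ-≤ P M+ac≤P ⟩
    P * P                     ∎
  identity : ∀ j y → (j + (y + y)) * (j + (y + y)) + (j * j + j + (y + y))
                   ≡ (j + (y + y)) * (j + j + 1) + (y + y) * (y + y)
  identity = solve-∀

c+1≤a+ac : ∀ a c → 1 ≤ a → c + 1 ≤ a + a * c
c+1≤a+ac a c 1≤a = begin
  c + 1         ≡⟨ +-comm c 1 ⟩
  suc c         ≡⟨ *-identityˡ (suc c) ⟨
  1 * suc c     ≤⟨ *-monoˡ-≤ (suc c) 1≤a ⟩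
  a * suc c     ≡⟨ *-suc a c ⟩
  a + a * c     ∎
  where open ≤-Reasoning

below-cone-at-s : ∀ {s i P M a c h} → i < s → 3 ≤ a → 3 * (s ∸ i) ≤ c + 1 →
  M + a * c ≡ P → a + a * c ≤ P → s + i + P ≡ h + h →
  ∃ λ y → s + y ≡ h × degBound s i P M < coneDegSum s y
below-cone-at-s {s} {i} {P} {M} {a} {c} {h} i<s 3≤a 3j≤c+1 M+ac≡P a+ac≤P total =
  y , s+y≡h , subst₂ (λ u v → degBound u i v M < coneDegSum u y) i+j≡s P≡
    (degBound<coneDegSum i j y M (M*P+1≤[y+y]² j y M a c 1≤j 3≤a 3j≤c+1 (≤-reflexive (trans M+ac≡P (sym P≡)))))
  where
  j : ℕ
  j = s ∸ i
  i+j≡s : i + j ≡ s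
  i+j≡s = m+[n∸m]≡n (<⇒≤ i<s)
  1≤j : 1 ≤ j
  1≤j = m+n≤o⇒m≤o∸n 1 i<s
  j≤P : j ≤ P
  j≤P = ≤-trans (m≤n*m j 3) (≤-trans 3j≤c+1 (≤-trans (c+1≤a+ac a c (≤-trans (s≤s z≤n) 3≤a)) a+ac≤P))
  regroup : ∀ s i j r → s + (i + j) + r ≡ s + i + (j + r)
  regroup = solve-∀
  halves : ∃ λ y → s + y ≡ h × P ∸ j ≡ y + y
  halves = half s (P ∸ j) h (begin
    s + s + (P ∸ j)         ≡⟨ cong (λ u → s + u + (P ∸ j)) i+j≡s ⟨
    s + (i + j) + (P ∸ j)   ≡⟨ regroup s i j (P ∸ j) ⟩
    s + i + (j + (P ∸ j))   ≡⟨ cong (s + i +_) (m+[n∸m]≡n j≤P) ⟩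
    s + i + P               ≡⟨ total ⟩
    h + h                   ∎)
    where open ≡-Reasoning
  y : ℕ
  y = proj₁ halves
  s+y≡h : s + y ≡ h
  s+y≡h = proj₁ (proj₂ halves)
  P≡ : j + (y + y) ≡ P
  P≡ = trans (cong (j +_) (sym (proj₂ (proj₂ halves)))) (m+[n∸m]≡n j≤P)

below-cone-at-d : ∀ {s P M a c h d} → 1 ≤ s → s < d → suc d ∸ s ≤ a → 3 * s ≤ c + 1 →
  M + a * c ≡ P → a + a * c ≤ P → s + 0 + P ≡ h + h →
  ∃ λ y → d + y ≡ h × degBound s 0 P M < coneDegSum d y
below-cone-at-d {suc s′} {P} {M} {a} {c} {h} {d} _ s<d d+1-s≤a 3s≤c+1 M+ac≡P a+ac≤P total =
  y , subst (λ u → u + y ≡ h) s+e≡d s+e+y≡h , subst₂ (λ u v → degBound s 0 v M < coneDegSum u y) s+e≡d P≡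
    (degBound<coneDegSum-shifted s′ e y M (begin
      M * P′ + (e + 1) * (3 * s′ + 2) * P′   ≡⟨ *-distribʳ-+ P′ M ((e + 1) * (3 * s′ + 2)) ⟨
      (M + (e + 1) * (3 * s′ + 2)) * P′      ≤⟨ *-monoˡ-≤ P′ (+-monoʳ-≤ M [e+1][3s′+2]≤ac) ⟩
      (M + a * c) * P′                       ≡⟨ cong (_* P′) (trans M+ac≡P (sym P≡)) ⟩
      P′ * P′                                ∎))
  where
  open ≤-Reasoning
  s : ℕ
  s = suc s′
  e : ℕ
  e = d ∸ s
  s+e≡d : s + e ≡ d
  s+e≡d = m+[n∸m]≡n (<⇒≤ s<d)
  e+1≤a : e + 1 ≤ a
  e+1≤a = subst (_≤ a) (trans (cong (_∸ s) (trans (cong suc (sym s+e≡d)) (sym (+-suc s e))))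
                              (trans (m+n∸m≡n s (suc e)) (+-comm 1 e))) d+1-s≤a
  3s′+2≤c : 3 * s′ + 2 ≤ c
  3s′+2≤c = +-cancelʳ-≤ 1 _ _ (≤-trans (≤-reflexive (3s≡ s′)) 3s≤c+1)
    where
    3s≡ : ∀ s′ → 3 * s′ + 2 + 1 ≡ 3 * suc s′
    3s≡ = solve-∀
  [e+1][3s′+2]≤ac : (e + 1) * (3 * s′ + 2) ≤ a * c
  [e+1][3s′+2]≤ac = *-mono-≤ e+1≤a 3s′+2≤c
  s+2e≤P : s + (e + e) ≤ P
  s+2e≤P = begin
    s + (e + e)                                           ≤⟨ m≤m+n _ (3 * s′ * e + 2 * s′ + e + 2) ⟩
    s + (e + e) + (3 * s′ * e + 2 * s′ + e + 2)           ≡⟨ identity s′ e ⟩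
    (e + 1) * (3 * s′ + 2) + (e + 1)                      ≤⟨ +-mono-≤ [e+1][3s′+2]≤ac e+1≤a ⟩
    a * c + a                                             ≡⟨ +-comm (a * c) a ⟩
    a + a * c                                             ≤⟨ a+ac≤P ⟩
    P                                                     ∎
    where
    identity : ∀ s′ e → suc s′ + (e + e) + (3 * s′ * e + 2 * s′ + e + 2) ≡ (e + 1) * (3 * s′ + 2) + (e + 1)
    identity = solve-∀
  R : ℕ
  R = P ∸ (s + (e + e))
  regroup : ∀ s e r → (s + e) + (s + e) + r ≡ s + 0 + (s + (e + e) + r)
  regroup = solve-∀
  halves : ∃ λ y → (s + e) + y ≡ h × R ≡ y + y
  halves = half (s + e) R h (trans (regroup s e R) (trans (cong (s + 0 +_) (m+[n∸m]≡n s+2e≤P)) total))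
  y : ℕ
  y = proj₁ halves
  s+e+y≡h : s + e + y ≡ h
  s+e+y≡h = proj₁ (proj₂ halves)
  P′ : ℕ
  P′ = s + (e + e) + (y + y)
  P≡ : P′ ≡ P
  P≡ = trans (cong (s + (e + e) +_) (sym (proj₂ (proj₂ halves)))) (m+[n∸m]≡n s+2e≤P)

-- Maximising coneDegSum t (h - t) over d ≤ t ≤ h

shift-identity : ∀ d x y →
  coneDegSum d (x + y) + x * (d + d + 1) ≡ coneDegSum (d + x) y + x * (x + (y + y + y + y))
shift-identity d x y = expanded d x y
  where
  expanded : ∀ d x y →
    (d + ((x + y) + (x + y))) * (d + ((x + y) + (x + y))) + (d * d + d * d) + d + x * (d + d + 1)
    ≡ ((d + x) + (y + y)) * ((d + x) + (y + y)) + ((d + x) * (d + x) + (d + x) * (d + x)) + (d + x)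
      + x * (x + (y + y + y + y))
  expanded = solve-∀

coneDegSum-shift≤ : ∀ d x y → d + d + 2 ≤ x + y → coneDegSum (d + x) y + x ≤ coneDegSum d (x + y)
coneDegSum-shift≤ d x y 2d+2≤x+y = +-cancelʳ-≤ (x * (d + d + 1)) _ _ (begin
  coneDegSum (d + x) y + x + x * (d + d + 1)     ≡⟨ regroup (coneDegSum (d + x) y) x d ⟩
  coneDegSum (d + x) y + x * (d + d + 2)         ≤⟨ +-monoʳ-≤ (coneDegSum (d + x) y)
                                                      (*-monoʳ-≤ x (≤-trans 2d+2≤x+y (+-monoʳ-≤ x (m≤n+m y (y + y + y))))) ⟩
  coneDegSum (d + x) y + x * (x + (y + y + y + y)) ≡⟨ shift-identity d x y ⟨
  coneDegSum d (x + y) + x * (d + d + 1)         ∎)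
  where
  open ≤-Reasoning
  regroup : ∀ w x d → w + x + x * (d + d + 1) ≡ w + x * (d + d + 2)
  regroup = solve-∀

coneDegSum-shift≡ : ∀ d x y → x + y ≡ d + d + 1 → coneDegSum (d + x) y + x * (y + y + y) ≡ coneDegSum d (x + y)
coneDegSum-shift≡ d x y x+y≡2d+1 = +-cancelʳ-≡ (x * (d + d + 1)) _ _ (begin
  coneDegSum (d + x) y + x * (y + y + y) + x * (d + d + 1)
    ≡⟨ cong (λ u → coneDegSum (d + x) y + x * (y + y + y) + x * u) x+y≡2d+1 ⟨
  coneDegSum (d + x) y + x * (y + y + y) + x * (x + y)           ≡⟨ regroup (coneDegSum (d + x) y) x y ⟩
  coneDegSum (d + x) y + x * (x + (y + y + y + y))               ≡⟨ shift-identity d x y ⟨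
  coneDegSum d (x + y) + x * (d + d + 1)                         ∎)
  where
  open ≡-Reasoning
  regroup : ∀ w x y → w + x * (y + y + y) + x * (x + y) ≡ w + x * (x + (y + y + y + y))
  regroup = solve-∀

coneDegSum-collapse : ∀ t y → y ≤ t + t → coneDegSum t y + y ≤ coneDegSum (t + y) 0
coneDegSum-collapse t y y≤2t = +-cancelʳ-≤ (y * (t + t)) _ _ (begin
  coneDegSum t y + y + y * (t + t)           ≡⟨ identity t y ⟩
  coneDegSum (t + y) 0 + y * y               ≤⟨ +-monoʳ-≤ (coneDegSum (t + y) 0) (*-monoʳ-≤ y y≤2t) ⟩
  coneDegSum (t + y) 0 + y * (t + t)         ∎)
  where
  open ≤-Reasoning
  identity : ∀ t y → coneDegSum t y + y + y * (t + t) ≡ coneDegSum (t + y) 0 + y * y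
  identity t y = expanded t y
    where
    expanded : ∀ t y → (t + (y + y)) * (t + (y + y)) + (t * t + t * t) + t + y + y * (t + t)
                     ≡ (t + y + 0) * (t + y + 0) + ((t + y) * (t + y) + (t + y) * (t + y)) + (t + y) + y * y
    expanded = solve-∀

split-at-d : ∀ {d t y h} → d ≤ t → t + y ≡ h → ∃ λ x → d + x ≡ t × h ∸ d ≡ x + y
split-at-d {d} {t} {y} {h} d≤t t+y≡h = t ∸ d , d+x≡t , (begin
  h ∸ d                 ≡⟨ cong (_∸ d) (trans (sym t+y≡h) (trans (cong (_+ y) (sym d+x≡t)) (+-assoc d (t ∸ d) y))) ⟩
  d + (t ∸ d + y) ∸ d   ≡⟨ m+n∸m≡n d (t ∸ d + y) ⟩
  t ∸ d + y             ∎)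
  where
  open ≡-Reasoning
  d+x≡t : d + (t ∸ d) ≡ t
  d+x≡t = m+[n∸m]≡n d≤t

peak-at-d : ∀ {d t y h} → 3 * d + 1 < h → d ≤ t → t + y ≡ h →
  coneDegSum t y ≤ coneDegSum d (h ∸ d) × (coneDegSum t y ≡ coneDegSum d (h ∸ d) → t ≡ d)
peak-at-d {d} {t} {y} {h} 3d+1<h d≤t t+y≡h with split-at-d d≤t t+y≡h
... | x , refl , h∸d≡x+y rewrite h∸d≡x+y =
  ≤-trans (m≤m+n _ x) shift , λ eq → trans (cong (d +_) (x≡0 eq)) (+-identityʳ d)
  where
  2d+2≤x+y : d + d + 2 ≤ x + y
  2d+2≤x+y = +-cancelˡ-≤ d _ _ (≤-trans (≤-reflexive (3d+2≡ d)) (≤-trans 3d+1<h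
               (≤-reflexive (trans (sym t+y≡h) (+-assoc d x y)))))
    where
    3d+2≡ : ∀ d → d + (d + d + 2) ≡ suc (3 * d + 1)
    3d+2≡ = solve-∀
  shift : coneDegSum (d + x) y + x ≤ coneDegSum d (x + y)
  shift = coneDegSum-shift≤ d x y 2d+2≤x+y
  x≡0 : coneDegSum (d + x) y ≡ coneDegSum d (x + y) → x ≡ 0
  x≡0 eq = n≤0⇒n≡0 (+-cancelˡ-≤ (coneDegSum (d + x) y) _ _
             (≤-trans shift (≤-reflexive (trans (sym eq) (sym (+-identityʳ _))))))

peak-at-d-and-h : ∀ {d t y h} → h ≡ 3 * d + 1 → d ≤ t → t + y ≡ h →
  coneDegSum t y ≤ coneDegSum d (h ∸ d) × (coneDegSum t y ≡ coneDegSum d (h ∸ d) → t ≡ d ⊎ t ≡ h)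
peak-at-d-and-h {d} {t} {y} {h} h≡3d+1 d≤t t+y≡h with split-at-d d≤t t+y≡h
... | x , refl , h∸d≡x+y rewrite h∸d≡x+y =
  ≤-trans (m≤m+n _ (x * (y + y + y))) (≤-reflexive shift) , endpoints
  where
  x+y≡2d+1 : x + y ≡ d + d + 1
  x+y≡2d+1 = +-cancelˡ-≡ d _ _ (trans (sym (+-assoc d x y)) (trans t+y≡h (trans h≡3d+1 (3d+1≡ d))))
    where
    3d+1≡ : ∀ d → 3 * d + 1 ≡ d + (d + d + 1)
    3d+1≡ = solve-∀
  shift : coneDegSum (d + x) y + x * (y + y + y) ≡ coneDegSum d (x + y)
  shift = coneDegSum-shift≡ d x y x+y≡2d+1
  endpoints : coneDegSum (d + x) y ≡ coneDegSum d (x + y) → d + x ≡ d ⊎ d + x ≡ h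
  endpoints eq with m*n≡0⇒m≡0∨n≡0 x (+-cancelˡ-≡ (coneDegSum (d + x) y) _ _
                      (trans shift (trans (sym eq) (sym (+-identityʳ _)))))
  ... | inj₁ x≡0 = inj₁ (trans (cong (d +_) x≡0) (+-identityʳ d))
  ... | inj₂ 3y≡0 = inj₂ (trans (sym (+-identityʳ (d + x))) (trans (cong (d + x +_) (sym y≡0)) t+y≡h))
    where
    y≡0 : y ≡ 0
    y≡0 = n≤0⇒n≡0 (≤-trans (m≤m+n y (y + y)) (≤-reflexive (trans (sym (+-assoc y y y)) 3y≡0)))

peak-at-h : ∀ {d t y h} → h < 3 * d + 1 → d ≤ t → t + y ≡ h →
  coneDegSum t y ≤ coneDegSum h 0 × (coneDegSum t y ≡ coneDegSum h 0 → t ≡ h)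
peak-at-h {d} {t} {y} {h} h<3d+1 d≤t refl =
  ≤-trans (m≤m+n _ y) collapse , λ eq → trans (sym (+-identityʳ t)) (cong (t +_) (sym (y≡0 eq)))
  where
  y≤2t : y ≤ t + t
  y≤2t = +-cancelˡ-≤ t _ _ (≤-pred (begin
    suc (t + y)          ≤⟨ h<3d+1 ⟩
    3 * d + 1            ≤⟨ +-monoˡ-≤ 1 (*-monoʳ-≤ 3 d≤t) ⟩
    3 * t + 1            ≡⟨ 3t+1≡ t ⟩
    suc (t + (t + t))    ∎))
    where
    open ≤-Reasoning
    3t+1≡ : ∀ t → 3 * t + 1 ≡ suc (t + (t + t))
    3t+1≡ = solve-∀
  collapse : coneDegSum t y + y ≤ coneDegSum (t + y) 0
  collapse = coneDegSum-collapse t y y≤2t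
  y≡0 : coneDegSum t y ≡ coneDegSum (t + y) 0 → y ≡ 0
  y≡0 eq = n≤0⇒n≡0 (+-cancelˡ-≤ (coneDegSum t y) _ _
             (≤-trans collapse (≤-reflexive (trans (sym eq) (sym (+-identityʳ _))))))

-- Recognising K_t ∨ (K_{n-2t} + K̄_t)

-- A value y missed by f would let punchOut y ∘ f inject Fin (suc m) into Fin m.
injective⇒surjective : ∀ {n} (f : Fin n → Fin n) → Injective _≡_ _≡_ f → ∀ y → ∃ λ x → f x ≡ y
injective⇒surjective {suc m} f f-inj y with any? (λ x → f x Fin.≟ y)
... | yes hit = hit
... | no  miss = ⊥-elim (<-irrefl refl (injective⇒≤ {f = squeeze} squeeze-inj))
  where
  squeeze : Fin (suc m) → Fin m
  squeeze x = punchOut {i = y} {j = f x} (λ eq → miss (x , sym eq))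
  squeeze-inj : Injective _≡_ _≡_ squeeze
  squeeze-inj {x} {x′} eq = f-inj (punchOut-injective (λ e → miss (x , sym e)) (λ e → miss (x′ , sym e)) eq)

injection⇒permutation : ∀ {n} (f : Fin n → Fin n) → Injective _≡_ _≡_ f →
  Σ[ π ∈ Permutation′ n ] ∀ x → π ⟨$⟩ʳ x ≡ f x
injection⇒permutation {n} f f-inj =
  permutation f f⁻¹ (λ y → proj₂ (surjective y)) (λ x → f-inj (proj₂ (surjective (f x)))) , λ _ → refl
  where
  surjective : ∀ y → ∃ λ x → f x ≡ y
  surjective = injective⇒surjective f f-inj
  f⁻¹ : Fin n → Fin n
  f⁻¹ = λ y → proj₁ (surjective y)

-- In K_t ∨ (K_{n-2t} + K̄_t) the hubs form K_t, the clique K_{n-2t} and the stable set K̄_t.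
data Layer : Set where
  hub clique stable : Layer

linked : Layer → Layer → Bool
linked hub    _      = true
linked clique hub    = true
linked clique clique = true
linked clique stable = false
linked stable hub    = true
linked stable _      = false

_==ᴸ_ : Layer → Layer → Bool
hub    ==ᴸ hub    = true
clique ==ᴸ clique = true
stable ==ᴸ stable = true
_      ==ᴸ _      = false

==ᴸ-refl : ∀ L → (L ==ᴸ L) ≡ true
==ᴸ-refl hub    = refl
==ᴸ-refl clique = refl
==ᴸ-refl stable = refl

Layered : ∀ {n} → Graph n → (Fin n → Layer) → Set
Layered {n} G layer = ∀ i j → adj G i j ≡ not (i == j) ∧ linked (layer i) (layer j)

count-layers : ∀ {n} (layer : Fin n → Layer) →
  count (λ v → layer v ==ᴸ hub) + count (λ v → layer v ==ᴸ clique) + count (λ v → layer v ==ᴸ stable) ≡ n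
count-layers {n} layer = begin
  count (is hub) + count (is clique) + count (is stable)
    ≡⟨ cong₂ _+_ (cong₂ _+_ (count≡sumF (is hub)) (count≡sumF (is clique))) (count≡sumF (is stable)) ⟩
  sumF (λ v → ⟦ is hub v ⟧) + sumF (λ v → ⟦ is clique v ⟧) + sumF (λ v → ⟦ is stable v ⟧)
    ≡⟨ cong (_+ sumF (λ v → ⟦ is stable v ⟧)) (sumF-distrib-+ (λ v → ⟦ is hub v ⟧) (λ v → ⟦ is clique v ⟧)) ⟨
  sumF (λ v → ⟦ is hub v ⟧ + ⟦ is clique v ⟧) + sumF (λ v → ⟦ is stable v ⟧)
    ≡⟨ sumF-distrib-+ (λ v → ⟦ is hub v ⟧ + ⟦ is clique v ⟧) (λ v → ⟦ is stable v ⟧) ⟨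
  sumF (λ v → ⟦ is hub v ⟧ + ⟦ is clique v ⟧ + ⟦ is stable v ⟧)
    ≡⟨ sumF-cong (λ v → one-layer (layer v)) ⟩
  sumF {n} (λ _ → 1)
    ≡⟨ trans (sumF-const {n} 1) (*-identityʳ n) ⟩
  n ∎
  where
  open ≡-Reasoning
  is : Layer → Fin n → Bool
  is L v = layer v ==ᴸ L
  one-layer : ∀ L → ⟦ L ==ᴸ hub ⟧ + ⟦ L ==ᴸ clique ⟧ + ⟦ L ==ᴸ stable ⟧ ≡ 1
  one-layer hub    = refl
  one-layer clique = refl
  one-layer stable = refl

layer-preserving⇒Iso : ∀ {n} (G H : Graph n) (ℓG ℓH : Fin n → Layer) → Layered G ℓG → Layered H ℓH →
  (f : Fin n → Fin n) → Injective _≡_ _≡_ f → (∀ v → ℓH (f v) ≡ ℓG v) → Iso G H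
layer-preserving⇒Iso G H ℓG ℓH G-layered H-layered f f-inj f-layer with injection⇒permutation f f-inj
... | π , π≗f = π , λ i j → begin
  adj G i j                                        ≡⟨ G-layered i j ⟩
  not (i == j) ∧ linked (ℓG i) (ℓG j)
    ≡⟨ cong₂ (λ e l → not e ∧ l) (sym (==-f i j)) (sym (cong₂ linked (f-layer i) (f-layer j))) ⟩
  not (f i == f j) ∧ linked (ℓH (f i)) (ℓH (f j))  ≡⟨ sym (H-layered (f i) (f j)) ⟩
  adj H (f i) (f j)                                ≡⟨ cong₂ (adj H) (π≗f i) (π≗f j) ⟨
  adj H (π ⟨$⟩ʳ i) (π ⟨$⟩ʳ j)                      ∎
  where
  open ≡-Reasoning
  ==-f : ∀ i j → (f i == f j) ≡ (i == j)
  ==-f i j = ⇔ᵇ⇒≡ (λ e → subst (λ z → (i == z) ≡ true) (f-inj (==⇒≡ (f i) (f j) e)) (==-refl i))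
                  (λ e → subst (λ z → (f i == f z) ≡ true) (==⇒≡ i j e) (==-refl (f i)))

layerOf : Bool → Bool → Layer
layerOf true  _     = hub
layerOf false true  = clique
layerOf false false = stable

coneLayer : ∀ n → ℕ → Fin n → Layer
coneLayer n t j = layerOf (toℕ j <ᵇ t) (toℕ j <ᵇ n ∸ t)

cone-layered : ∀ n t → Layered (coneGraph n t) (coneLayer n t)
cone-layered n t i j = cong (not (i == j) ∧_) (adjacency (toℕ i <ᵇ t) (toℕ i <ᵇ n ∸ t) (toℕ j <ᵇ t) (toℕ j <ᵇ n ∸ t))
  where
  adjacency : ∀ a m a′ m′ →
    (a ∨ a′ ∨ ((not a ∧ m) ∧ (not a′ ∧ m′))) ∨ (a′ ∨ a ∨ ((not a′ ∧ m′) ∧ (not a ∧ m)))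
    ≡ linked (layerOf a m) (layerOf a′ m′)
  adjacency true  true  true  true  = refl
  adjacency true  true  true  false = refl
  adjacency true  true  false true  = refl
  adjacency true  true  false false = refl
  adjacency true  false true  true  = refl
  adjacency true  false true  false = refl
  adjacency true  false false true  = refl
  adjacency true  false false false = refl
  adjacency false true  true  true  = refl
  adjacency false true  true  false = refl
  adjacency false true  false true  = refl
  adjacency false true  false false = refl
  adjacency false false true  true  = refl
  adjacency false false true  false = refl
  adjacency false false false true  = refl
  adjacency false false false false = refl

rank : ∀ {n} → (Fin n → Bool) → Fin n → ℕ
rank P v = count (λ w → P w ∧ (toℕ w <ᵇ toℕ v))

rank-mono-< : ∀ {n} (P : Fin n → Bool) v w → P w ≡ true → toℕ w < toℕ v → rank P w < rank P v
rank-mono-< P v w Pw w<v = count-mono-< below-w⊆below-v w (∧-intro Pw (<⇒<ᵇ′ w<v))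
  (trans (cong (P w ∧_) (<ᵇ-irrefl (toℕ w))) (∧-zeroʳ (P w)))
  where
  below-w⊆below-v : (λ x → P x ∧ (toℕ x <ᵇ toℕ w)) ⊆ᵇ (λ x → P x ∧ (toℕ x <ᵇ toℕ v))
  below-w⊆below-v x e = let (Px , x<w) = ∧-true {P x} e in ∧-intro Px (<⇒<ᵇ′ (<-trans (<ᵇ⇒<′ x<w) w<v))

rank<count : ∀ {n} (P : Fin n → Bool) v → P v ≡ true → rank P v < count P
rank<count P v Pv = count-mono-< (λ w e → proj₁ (∧-true {P w} e)) v Pv
  (trans (cong (P v ∧_) (<ᵇ-irrefl (toℕ v))) (∧-zeroʳ (P v)))

rank-injective : ∀ {n} (P : Fin n → Bool) v w → P v ≡ true → P w ≡ true → rank P v ≡ rank P w → v ≡ w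
rank-injective P v w Pv Pw eq with <-cmp (toℕ v) (toℕ w)
... | tri< v<w _ _ = ⊥-elim (<-irrefl eq (rank-mono-< P w v Pv v<w))
... | tri≈ _ v≡w _ = toℕ-injective v≡w
... | tri> _ _ w<v = ⊥-elim (<-irrefl (sym eq) (rank-mono-< P v w Pw w<v))

-- Number the hubs first, then the clique, then the stable set, each layer in
-- increasing order, as coneGraph does.
module ConeEmbedding {n} (t : ℕ) (layer : Fin n → Layer)
  (hubs : count (λ v → layer v ==ᴸ hub) ≡ t) (stables : count (λ v → layer v ==ᴸ stable) ≡ t) where

  is : Layer → Fin n → Bool
  is L v = layer v ==ᴸ L

  b : ℕ
  b = count (is clique)

  n≡t+b+t : n ≡ t + b + t
  n≡t+b+t = sym (trans (cong₂ (λ x z → x + b + z) (sym hubs) (sym stables)) (count-layers layer))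

  n∸t≡t+b : n ∸ t ≡ t + b
  n∸t≡t+b = trans (cong (_∸ t) (trans n≡t+b+t (+-comm (t + b) t))) (m+n∸m≡n t (t + b))

  positionAt : Layer → Fin n → ℕ
  positionAt hub    v = rank (is hub) v
  positionAt clique v = t + rank (is clique) v
  positionAt stable v = (n ∸ t) + rank (is stable) v

  position : Fin n → ℕ
  position v = positionAt (layer v) v

  rank<  : ∀ L v → layer v ≡ L → rank (is L) v < count (is L)
  rank< L v refl = rank<count (is L) v (==ᴸ-refl (layer v))

  position-bounds : ∀ L v → layer v ≡ L →
    layerOf (positionAt L v <ᵇ t) (positionAt L v <ᵇ n ∸ t) ≡ L × positionAt L v < n
  position-bounds hub v e rewrite <⇒<ᵇ′ (subst (rank (is hub) v <_) hubs (rank< hub v e)) = refl , (begin-strict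
    rank (is hub) v   <⟨ r<t ⟩
    t                 ≤⟨ m≤n+m t (t + b) ⟩
    t + b + t         ≡⟨ n≡t+b+t ⟨
    n                 ∎)
    where
    open ≤-Reasoning
    r<t : rank (is hub) v < t
    r<t = subst (rank (is hub) v <_) hubs (rank< hub v e)
  position-bounds clique v e
    rewrite ≮⇒<ᵇ-false (≤⇒≯ (m≤m+n t (rank (is clique) v))) | n∸t≡t+b | <⇒<ᵇ′ (+-monoʳ-< t (rank< clique v e))
    = refl , (begin-strict
      t + rank (is clique) v   <⟨ t+r<t+b ⟩
      t + b                    ≤⟨ m≤m+n (t + b) t ⟩
      t + b + t                ≡⟨ n≡t+b+t ⟨
      n                        ∎)
    where
    open ≤-Reasoning
    t+r<t+b : t + rank (is clique) v < t + b
    t+r<t+b = +-monoʳ-< t (rank< clique v e)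
  position-bounds stable v e
    rewrite n∸t≡t+b | ≮⇒<ᵇ-false (≤⇒≯ (≤-trans (m≤m+n t b) (m≤m+n (t + b) (rank (is stable) v))))
          | ≮⇒<ᵇ-false (≤⇒≯ (m≤m+n (t + b) (rank (is stable) v))) = refl , (begin-strict
      t + b + rank (is stable) v   <⟨ +-monoʳ-< (t + b) (subst (rank (is stable) v <_) stables (rank< stable v e)) ⟩
      t + b + t                    ≡⟨ n≡t+b+t ⟨
      n                            ∎)
    where open ≤-Reasoning

  position-layer : ∀ v → layerOf (position v <ᵇ t) (position v <ᵇ n ∸ t) ≡ layer v
  position-layer v = proj₁ (position-bounds (layer v) v refl)

  embed : Fin n → Fin n
  embed v = fromℕ< (proj₂ (position-bounds (layer v) v refl))

  toℕ-embed : ∀ v → toℕ (embed v) ≡ position v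
  toℕ-embed v = toℕ-fromℕ< _

  embed-layer : ∀ v → coneLayer n t (embed v) ≡ layer v
  embed-layer v = trans (cong (λ p → layerOf (p <ᵇ t) (p <ᵇ n ∸ t)) (toℕ-embed v)) (position-layer v)

  positionAt-injective : ∀ L v w → layer v ≡ L → layer w ≡ L → positionAt L v ≡ positionAt L w → v ≡ w
  positionAt-injective L v w refl w∈L eq = rank-injective (is L) v w (==ᴸ-refl L)
    (subst (λ M → (M ==ᴸ L) ≡ true) (sym w∈L) (==ᴸ-refl L)) (cancel L eq)
    where
    cancel : ∀ L → positionAt L v ≡ positionAt L w → rank (is L) v ≡ rank (is L) w
    cancel hub    eq = eq
    cancel clique eq = +-cancelˡ-≡ t _ _ eq
    cancel stable eq = +-cancelˡ-≡ (n ∸ t) _ _ eq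

  embed-injective : Injective _≡_ _≡_ embed
  embed-injective {v} {w} eq = positionAt-injective (layer v) v w refl (sym same-layer)
    (trans position-eq (cong (λ L → positionAt L w) (sym same-layer)))
    where
    position-eq : position v ≡ position w
    position-eq = trans (sym (toℕ-embed v)) (trans (cong toℕ eq) (toℕ-embed w))
    same-layer : layer v ≡ layer w
    same-layer = trans (sym (embed-layer v)) (trans (cong (coneLayer n t) eq) (embed-layer w))

layered⇒≅cone : ∀ {n} (G : Graph n) t (layer : Fin n → Layer) → Layered G layer →
  count (λ v → layer v ==ᴸ hub) ≡ t → count (λ v → layer v ==ᴸ stable) ≡ t → Iso G (coneGraph n t)
layered⇒≅cone {n} G t layer G-layered hubs stables =
  layer-preserving⇒Iso G (coneGraph n t) layer (coneLayer n t) G-layered (cone-layered n t) embed embed-injective embed-layer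
  where open ConeEmbedding t layer hubs stables

module LayeredDegrees {n} (G : Graph n) (layer : Fin n → Layer) (G-layered : Layered G layer) where

  is : Layer → Fin n → Bool
  is L v = layer v ==ᴸ L

  #hub #clique #stable : ℕ
  #hub    = count (is hub)
  #clique = count (is clique)
  #stable = count (is stable)

  deg+⟦⟧ : ∀ v (X : Fin n → Bool) → (∀ j → linked (layer v) (layer j) ≡ X j) → deg G v + ⟦ X v ⟧ ≡ count X
  deg+⟦⟧ v X linked≡X =
    trans (cong (_+ ⟦ X v ⟧) (count-cong (λ j → trans (G-layered v j) (cong (not (v == j) ∧_) (linked≡X j)))))
          (sym (count-remove v X))

  deg+1 : ∀ v → deg G v + 1 ≡ (if is hub v then n else (if is stable v then #hub + 1 else #hub + #clique))
  deg+1 v with layer v in e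
  ... | hub    = trans (deg+⟦⟧ v (λ _ → true) (λ j → cong (λ L → linked L (layer j)) e)) count-true
  ... | clique = begin
    deg G v + 1                                 ≡⟨ cong (λ L → deg G v + ⟦ (L ==ᴸ hub) ∨ (L ==ᴸ clique) ⟧) e ⟨
    deg G v + ⟦ is hub v ∨ is clique v ⟧        ≡⟨ deg+⟦⟧ v (λ j → is hub j ∨ is clique j)
                                                     (λ j → trans (cong (λ L → linked L (layer j)) e) (clique-row (layer j))) ⟩
    count (λ j → is hub j ∨ is clique j)        ≡⟨ count-∨-disjoint (is hub) (is clique) (λ j → disjoint (layer j)) ⟩
    #hub + #clique                              ∎
    where
    open ≡-Reasoning
    clique-row : ∀ L → linked clique L ≡ (L ==ᴸ hub) ∨ (L ==ᴸ clique)
    clique-row hub    = refl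
    clique-row clique = refl
    clique-row stable = refl
    disjoint : ∀ L → (L ==ᴸ hub) ∧ (L ==ᴸ clique) ≡ false
    disjoint hub    = refl
    disjoint clique = refl
    disjoint stable = refl
  ... | stable = begin
    deg G v + 1                   ≡⟨ cong (_+ 1) (+-identityʳ (deg G v)) ⟨
    deg G v + 0 + 1               ≡⟨ cong (λ L → deg G v + ⟦ L ==ᴸ hub ⟧ + 1) e ⟨
    deg G v + ⟦ is hub v ⟧ + 1    ≡⟨ cong (_+ 1) (deg+⟦⟧ v (is hub)
                                         (λ j → trans (cong (λ L → linked L (layer j)) e) (stable-row (layer j)))) ⟩
    #hub + 1                      ∎
    where
    open ≡-Reasoning
    stable-row : ∀ L → linked stable L ≡ (L ==ᴸ hub)
    stable-row hub    = refl
    stable-row clique = refl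
    stable-row stable = refl

  closedDegSum-layered : closedDegSum G ≡ #hub * n + #stable * (#hub + 1) + #clique * (#hub + #clique)
  closedDegSum-layered = trans (sumF-cong deg+1)
    (trans (sumF-by-class (is hub) (is stable) n (#hub + 1) (#hub + #clique) (λ v → hub∧stable (layer v)))
           (cong (λ c → #hub * n + #stable * (#hub + 1) + c * (#hub + #clique)) (count-cong (λ v → neither (layer v)))))
    where
    hub∧stable : ∀ L → (L ==ᴸ hub) ∧ (L ==ᴸ stable) ≡ false
    hub∧stable hub    = refl
    hub∧stable clique = refl
    hub∧stable stable = refl
    neither : ∀ L → not (L ==ᴸ hub) ∧ not (L ==ᴸ stable) ≡ (L ==ᴸ clique)
    neither hub    = refl
    neither clique = refl
    neither stable = refl

count-<ᵇ : ∀ {n} m → m ≤ n → count {n} (λ j → toℕ j <ᵇ m) ≡ m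
count-<ᵇ {zero}  zero    z≤n       = refl
count-<ᵇ {suc n} zero    z≤n       = ∀false⇒count≡0 {n} _ (λ _ → refl)
count-<ᵇ {suc n} (suc m) (s≤s m≤n) = cong suc (count-<ᵇ {n} m m≤n)

cone-closedDegSum : ∀ t y → closedDegSum (coneGraph (t + (t + (y + y))) t) ≡ coneDegSum t y
cone-closedDegSum t y = begin
  closedDegSum (coneGraph n t)                                      ≡⟨ closedDegSum-layered ⟩
  #hub * n + #stable * (#hub + 1) + #clique * (#hub + #clique)
    ≡⟨ cong₂ (λ a c → a * n + c * (a + 1) + #clique * (a + #clique)) hubs stables ⟩
  t * n + t * (t + 1) + #clique * (t + #clique)
    ≡⟨ cong (λ b → t * n + t * (t + 1) + b * (t + b)) cliques ⟩
  t * n + t * (t + 1) + (y + y) * (t + (y + y))                     ≡⟨ identity t y ⟩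
  coneDegSum t y                                                    ∎
  where
  open ≡-Reasoning
  n : ℕ
  n = t + (t + (y + y))
  open LayeredDegrees (coneGraph n t) (coneLayer n t) (cone-layered n t)
  n∸t≡ : n ∸ t ≡ t + (y + y)
  n∸t≡ = m+n∸m≡n t (t + (y + y))
  hubs : #hub ≡ t
  hubs = trans (count-cong {n} (λ j → hub? (toℕ j <ᵇ t) (toℕ j <ᵇ n ∸ t))) (count-<ᵇ {n} t (m≤m+n t _))
    where
    hub? : ∀ a m → (layerOf a m ==ᴸ hub) ≡ a
    hub? true  _     = refl
    hub? false true  = refl
    hub? false false = refl
  stable? : ∀ j → (coneLayer n t j ==ᴸ stable) ≡ not (toℕ j <ᵇ n ∸ t)
  stable? j with toℕ j <ᵇ t in j<t | toℕ j <ᵇ n ∸ t in j<n∸t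
  ... | false | true  = refl
  ... | false | false = refl
  ... | true  | true  = refl
  ... | true  | false =
    ⊥-elim (true≢false (<⇒<ᵇ′ (≤-trans (<ᵇ⇒<′ j<t) (≤-trans (m≤m+n t (y + y)) (≤-reflexive (sym n∸t≡))))) j<n∸t)
  stables : #stable ≡ t
  stables = +-cancelˡ-≡ (n ∸ t) _ _ (begin
    n ∸ t + #stable
      ≡⟨ cong₂ _+_ (count-<ᵇ {n} (n ∸ t) (m∸n≤m n t)) (sym (count-cong {n} stable?)) ⟨
    count {n} (λ j → toℕ j <ᵇ n ∸ t) + count {n} (λ j → not (toℕ j <ᵇ n ∸ t))
      ≡⟨ count-split {n} (λ _ → true) (λ j → toℕ j <ᵇ n ∸ t) ⟨
    count {n} (λ _ → true)
      ≡⟨ count-true ⟩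
    n
      ≡⟨ m∸n+n≡m (m≤m+n t _) ⟨
    n ∸ t + t
      ∎)
  cliques : #clique ≡ y + y
  cliques = +-cancelʳ-≡ t _ _ (+-cancelˡ-≡ t _ _ (begin
    t + (#clique + t)       ≡⟨ +-assoc t #clique t ⟨
    t + #clique + t         ≡⟨ cong₂ (λ a c → a + #clique + c) hubs stables ⟨
    #hub + #clique + #stable ≡⟨ count-layers (coneLayer n t) ⟩
    n                       ≡⟨ cong (t +_) (+-comm t (y + y)) ⟩
    t + (y + y + t)         ∎))
  identity : ∀ t y → t * (t + (t + (y + y))) + t * (t + 1) + (y + y) * (t + (y + y))
                   ≡ (t + (y + y)) * (t + (y + y)) + (t * t + t * t) + t
  identity = solve-∀

-- A nonempty barrier forces G below a cone

record ConeBound {n} (G : Graph n) (d h : ℕ) : Set where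
  field
    t y        : ℕ
    d≤t        : d ≤ t
    t+y≡h      : t + y ≡ h
    below      : closedDegSum G ≤ coneDegSum t y
    tight⇒cone : closedDegSum G ≡ coneDegSum t y → Iso G (coneGraph n t)

module DegreeBound {n} (G : Graph n) (S : Subset n) where
  open Components G S public

  i P : ℕ
  i = count isolated
  P = count nontrivial

  s+i+P≡n : s + i + P ≡ n
  s+i+P≡n = trans (trans (+-assoc s i P) (+-comm s (i + P))) (trans (cong (_+ s) (sym count-out)) count-out+s)

  boundAt : ℕ → Fin n → ℕ
  boundAt Z v = if inS v then n else (if isolated v then s + 1 else s + Z)

  LargestComponent : ℕ → Set
  LargestComponent Z = ∀ v → nontrivial v ≡ true → size v ≤ Z

  deg+1≤boundAt : ∀ {Z} → LargestComponent Z → ∀ v → deg G v + 1 ≤ boundAt Z v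
  deg+1≤boundAt {Z} size≤Z v = by-class (inS v) (isolated v) refl refl
    where
    by-class : ∀ a b → inS v ≡ a → isolated v ≡ b → deg G v + 1 ≤ (if a then n else (if b then s + 1 else s + Z))
    by-class true  _     _    _     = deg+1≤n v
    by-class false true  _    v-iso = +-monoˡ-≤ 1 (deg-isolated≤s v v-iso)
    by-class false false v∉S  v-iso = ≤-trans (deg+1≤s+size v (cong not v∉S))
                                        (+-monoʳ-≤ s (size≤Z v (∧-intro (cong not v∉S) (cong not v-iso))))

  sumF-boundAt : ∀ Z → sumF (boundAt Z) ≡ degBound s i P Z
  sumF-boundAt Z = trans (sumF-by-class inS isolated n (s + 1) (s + Z) (λ v → inS∧isolated v))
                         (cong (λ m → s * m + i * (s + 1) + P * (s + Z)) (sym s+i+P≡n))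
    where
    inS∧isolated : ∀ v → inS v ∧ isolated v ≡ false
    inS∧isolated v with inS v
    ... | true  = refl
    ... | false = refl

  closedDegSum≤degBound : ∀ {Z} → LargestComponent Z → closedDegSum G ≤ degBound s i P Z
  closedDegSum≤degBound {Z} size≤Z = ≤-trans (sumF-mono (deg+1≤boundAt size≤Z)) (≤-reflexive (sumF-boundAt Z))

  classify : Bool → Bool → Layer
  classify true  _     = hub
  classify false true  = stable
  classify false false = clique

  layer : Fin n → Layer
  layer v = classify (inS v) (isolated v)

  module Tight (size≤P : LargestComponent P) (tight : ∀ v → deg G v + 1 ≡ boundAt P v) where

    ≢-across-S : ∀ {i j} → inS i ≡ false → inS j ≡ true → not (i == j) ≡ true
    ≢-across-S {i} {j} i∉S j∈S = cong not (≢⇒==-false {i = i} {j} (λ { refl → true≢false j∈S i∉S }))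

    adj-S : ∀ v → inS v ≡ true → ∀ j → adj G v j ≡ not (v == j)
    adj-S v v∈S = ⊆ᵇ∧count≥⇒≗ (adj⊆≢ v) (+-cancelʳ-≤ 1 _ _ (≤-reflexive (begin
      count (λ j → not (v == j)) + 1   ≡⟨ count-≢ v ⟩
      n                                ≡⟨ cong (λ a → if a then n else (if isolated v then s + 1 else s + P)) v∈S ⟨
      boundAt P v                      ≡⟨ tight v ⟨
      deg G v + 1                      ∎)))
      where open ≡-Reasoning

    adj-isolated : ∀ v → isolated v ≡ true → ∀ j → adj G v j ≡ inS j
    adj-isolated v v-iso = ⊆ᵇ∧count≥⇒≗ (adj-isolated⊆S v v-iso) (+-cancelʳ-≤ 1 _ _ (≤-reflexive (begin
      s + 1                                         ≡⟨ cong (λ b → if b then s + 1 else s + P) v-iso ⟨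
      (if isolated v then s + 1 else s + P)         ≡⟨ cong (λ a → if a then n else (if isolated v then s + 1 else s + P)) v∉S ⟨
      boundAt P v                                   ≡⟨ tight v ⟨
      deg G v + 1                                   ∎)))
      where
      open ≡-Reasoning
      v∉S : inS v ≡ false
      v∉S = not-true (isolated⇒out v v-iso)

    adj-nontrivial : ∀ v → nontrivial v ≡ true → ∀ j → adj G v j ≡ inS j ∨ (not (v == j) ∧ nontrivial j)
    adj-nontrivial v v-big j = trans (⊆ᵇ∧count≥⇒≗ (adj⊆possibleNbr v v-out) possible≤deg j)
                                     (cong (λ c → inS j ∨ (not (v == j) ∧ c)) (⊆ᵇ∧count≥⇒≗ conn⊆nontrivial P≤size j))
      where
      v-out : out S v ≡ true
      v-out = proj₁ (∧-true {out S v} v-big)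
      deg+1≡s+P : deg G v + 1 ≡ s + P
      deg+1≡s+P = trans (tight v) (trans (cong (λ a → if a then n else (if isolated v then s + 1 else s + P)) (not-true v-out))
                                         (cong (λ b → if b then s + 1 else s + P) (not-true (proj₂ (∧-true {out S v} v-big)))))
      s+size≤s+P : s + size v ≤ s + P
      s+size≤s+P = +-monoʳ-≤ s (size≤P v v-big)
      possible≤deg : count (possibleNbr v) ≤ deg G v
      possible≤deg = +-cancelʳ-≤ 1 _ _
        (≤-trans (≤-reflexive (count-possibleNbr v v-out)) (≤-trans s+size≤s+P (≤-reflexive (sym deg+1≡s+P))))
      P≤size : P ≤ size v
      P≤size = +-cancelˡ-≤ s _ _ (≤-trans (≤-reflexive (sym deg+1≡s+P)) (deg+1≤s+size v v-out))
      conn⊆nontrivial : conn G S v ⊆ᵇ nontrivial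
      conn⊆nontrivial w c with isolated w in w-iso
      ... | false = ∧-intro (proj₂ (conn-ends v w c)) refl
      ... | true  = ⊥-elim (true≢false (subst (λ x → isolated x ≡ true) (sym (conn-isolated v w w-iso c)) w-iso)
                                       (not-true (proj₂ (∧-true {out S v} v-big))))

    layered : Layered G layer
    layered i j = by-class (inS i) (isolated i) refl refl
      where
      stable-row : ∀ a b → linked stable (classify a b) ≡ a
      stable-row true  _     = refl
      stable-row false true  = refl
      stable-row false false = refl
      clique-row : ∀ a b → linked clique (classify a b) ≡ a ∨ not b
      clique-row true  _     = refl
      clique-row false true  = refl
      clique-row false false = refl
      absorb : ∀ {e a} → (a ≡ true → e ≡ true) → a ≡ e ∧ a
      absorb {e} {true}  a⇒e rewrite a⇒e refl = refl
      absorb {e} {false} _ = sym (∧-zeroʳ e)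
      absorb-∨ : ∀ {e a} b → (a ≡ true → e ≡ true) → a ∨ (e ∧ (not a ∧ not b)) ≡ e ∧ (a ∨ not b)
      absorb-∨ {e} {true}  b a⇒e rewrite a⇒e refl = refl
      absorb-∨ {e} {false} b _ = refl
      by-class : ∀ a b → inS i ≡ a → isolated i ≡ b → adj G i j ≡ not (i == j) ∧ linked (classify a b) (layer j)
      by-class true  _     i∈S   _     = trans (adj-S i i∈S j) (sym (∧-identityʳ _))
      by-class false true  i∉S   i-iso = trans (adj-isolated i i-iso j)
        (trans (absorb (≢-across-S i∉S)) (cong (not (i == j) ∧_) (sym (stable-row (inS j) (isolated j)))))
      by-class false false i∉S   i-niso = trans (adj-nontrivial i (∧-intro (cong not i∉S) (cong not i-niso)) j)
        (trans (absorb-∨ (isolated j) (≢-across-S i∉S)) (cong (not (i == j) ∧_) (sym (clique-row (inS j) (isolated j)))))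

  count-hub-layer : count (λ v → layer v ==ᴸ hub) ≡ s
  count-hub-layer = count-cong (λ v → hub? (inS v) (isolated v))
    where
    hub? : ∀ a b → (classify a b ==ᴸ hub) ≡ a
    hub? true  _     = refl
    hub? false true  = refl
    hub? false false = refl

  count-stable-layer : count (λ v → layer v ==ᴸ stable) ≡ i
  count-stable-layer = count-cong stable?
    where
    stable? : ∀ v → (layer v ==ᴸ stable) ≡ isolated v
    stable? v = by-S (inS v) refl
      where
      by-S : ∀ a → inS v ≡ a → (classify a (isolated v) ==ᴸ stable) ≡ isolated v
      by-S true  v∈S = sym (cong (λ a → not a ∧ (size v ≡ᵇ 1)) v∈S)
      by-S false _   with isolated v
      ... | true  = refl
      ... | false = refl

module BarrierAnalysis {n} (G : Graph n) (S : Subset n) {k d h : ℕ} (n≡h+h : n ≡ h + h) (3≤k : 3 ≤ k)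
  (min-deg : MinDegreeAtLeast G d) (1≤s : 1 ≤ count (lookup S))
  (barrier : k * count (lookup S) ≤ odd# G S + k * iso# G S) where
  open DegreeBound G S

  q : ℕ
  q = count oddRep

  isolated⇒d≤s : 1 ≤ i → d ≤ s
  isolated⇒d≤s 1≤i = let (w , w-iso) = count≥1⇒∃ isolated 1≤i in ≤-trans (min-deg w) (deg-isolated≤s w w-iso)

  s+s+[j+P]≡h+h : ∀ {j} → i ≡ s + j → s + s + (j + P) ≡ h + h
  s+s+[j+P]≡h+h {j} i≡s+j = trans (regroup s j P) (trans (cong (λ x → s + x + P) (sym i≡s+j)) (trans s+i+P≡n n≡h+h))
    where
    regroup : ∀ s j P → s + s + (j + P) ≡ s + (s + j) + P
    regroup = solve-∀

  coneBound-if-s≤i : s ≤ i → ConeBound G d h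
  coneBound-if-s≤i s≤i = record
    { t = s ; y = y ; d≤t = isolated⇒d≤s (≤-trans 1≤s s≤i) ; t+y≡h = s+y≡h
    ; below = ≤-trans (closedDegSum≤degBound size≤P) bound≤cone
    ; tight⇒cone = tight⇒cone }
    where
    j : ℕ
    j = i ∸ s
    i≡s+j : i ≡ s + j
    i≡s+j = sym (m+[n∸m]≡n s≤i)
    halves : ∃ λ y → s + y ≡ h × j + P ≡ y + y
    halves = half s (j + P) h (s+s+[j+P]≡h+h i≡s+j)
    y : ℕ
    y = proj₁ halves
    s+y≡h : s + y ≡ h
    s+y≡h = proj₁ (proj₂ halves)
    P+j≡y+y : P + j ≡ y + y
    P+j≡y+y = trans (+-comm P j) (proj₂ (proj₂ halves))
    size≤P : LargestComponent P
    size≤P v v-big = +-cancelʳ-≤ i _ _ (≤-trans (≤-trans (≤-reflexive (sym (+-identityʳ _)))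
                       (size+isolated+far≤out v (not-true (proj₂ (∧-true {out S v} v-big))) 0 (λ _ _ → z≤n)))
                       (≤-reflexive (trans count-out (+-comm i P))))
    bound≤cone : degBound s i P P ≤ coneDegSum s y
    bound≤cone = subst (λ x → degBound s x P P ≤ coneDegSum s y) (sym i≡s+j) (degBound≤coneDegSum s j P y P+j≡y+y)
    tight⇒cone : closedDegSum G ≡ coneDegSum s y → Iso G (coneGraph n s)
    tight⇒cone eq = layered⇒≅cone G s layer layered count-hub-layer (trans count-stable-layer i≡s)
      where
      cone≤bound : coneDegSum s y ≤ degBound s i P P
      cone≤bound = ≤-trans (≤-reflexive (sym eq)) (closedDegSum≤degBound size≤P)
      i≡s : i ≡ s
      i≡s = trans i≡s+j (trans (cong (s +_) (coneDegSum≤degBound⇒j≡0 s j P y P+j≡y+y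
                (subst (λ x → coneDegSum s y ≤ degBound s x P P) i≡s+j cone≤bound))) (+-identityʳ s))
      tight : ∀ v → deg G v + 1 ≡ boundAt P v
      tight = sumF-≤-tight (deg+1≤boundAt size≤P)
        (≤-trans (≤-reflexive (sumF-boundAt P)) (≤-trans bound≤cone (≤-reflexive (sym eq))))
      open Tight size≤P tight

  module ManyOddComponents (i<s : i < s) where
    strictly-below : ∀ {t y} → d ≤ t → t + y ≡ h → closedDegSum G < coneDegSum t y → ConeBound G d h
    strictly-below {t} {y} d≤t t+y≡h below = record
      { t = t ; y = y ; d≤t = d≤t ; t+y≡h = t+y≡h ; below = <⇒≤ below
      ; tight⇒cone = λ eq → ⊥-elim (<-irrefl eq below) }
    j : ℕ
    j = s ∸ i
    3j≤q : 3 * j ≤ q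
    3j≤q = ≤-trans (*-monoˡ-≤ j 3≤k) (+-cancelʳ-≤ (k * i) _ _ (begin
      k * j + k * i     ≡⟨ +-comm (k * j) (k * i) ⟩
      k * i + k * j     ≡⟨ *-distribˡ-+ k i j ⟨
      k * (i + j)       ≡⟨ cong (k *_) (m+[n∸m]≡n (<⇒≤ i<s)) ⟩
      k * s             ≤⟨ barrier ⟩
      q + k * i         ∎))
      where open ≤-Reasoning
    1≤q : 1 ≤ q
    1≤q = ≤-trans (m+n≤o⇒m≤o∸n 1 i<s) (≤-trans (m≤n*m j 3) 3j≤q)
    c : ℕ
    c = q ∸ 1
    q≡c+1 : q ≡ c + 1
    q≡c+1 = sym (m∸n+n≡m 1≤q)
    3j≤c+1 : 3 * j ≤ c + 1
    3j≤c+1 = subst (3 * j ≤_) q≡c+1 3j≤q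
    -- every odd component has at least 3 vertices, and at least d + 1 - s because
    -- its vertices have degree at least d
    a : ℕ
    a = 3 ⊔ (suc d ∸ s)
    3≤a : 3 ≤ a
    3≤a = m≤m⊔n 3 (suc d ∸ s)
    a≤size : ∀ r → oddRep r ≡ true → a ≤ size r
    a≤size r r-odd = ⊔-lub (oddRep⇒size≥3 r r-odd)
      (m≤n+o⇒m∸n≤o (suc d) s (≤-trans (≤-trans (s≤s (min-deg r)) (≤-reflexive (+-comm 1 (deg G r))))
                                       (deg+1≤s+size r (oddRep⇒out r r-odd))))
    size+ac≤P : ∀ v → nontrivial v ≡ true → size v + a * c ≤ P
    size+ac≤P v v-big = +-cancelˡ-≤ i _ _ (begin
      i + (size v + a * c)                    ≡⟨ regroup i (size v) (a * c) ⟩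
      size v + i + a * c                      ≤⟨ +-monoʳ-≤ (size v + i) (*-monoʳ-≤ a c≤far) ⟩
      size v + i + a * count (farOddRep v)    ≤⟨ size+isolated+far≤out v (not-true (proj₂ (∧-true {out S v} v-big))) a a≤size ⟩
      count (out S)                           ≡⟨ count-out ⟩
      i + P                                   ∎)
      where
      open ≤-Reasoning
      regroup : ∀ i x y → i + (x + y) ≡ x + i + y
      regroup = solve-∀
      c≤far : c ≤ count (farOddRep v)
      c≤far = +-cancelʳ-≤ 1 _ _ (≤-trans (≤-reflexive (sym q≡c+1))
                (≤-trans (count-oddRep≤1+far v) (≤-reflexive (+-comm 1 _))))
    a+ac≤P : a + a * c ≤ P
    a+ac≤P = let (r , r-odd) = count≥1⇒∃ oddRep 1≤q in
      ≤-trans (+-monoˡ-≤ (a * c) (a≤size r r-odd))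
              (size+ac≤P r (∧-intro (oddRep⇒out r r-odd) (cong not (oddRep⇒¬isolated r r-odd))))
    M : ℕ
    M = P ∸ a * c
    M+ac≡P : M + a * c ≡ P
    M+ac≡P = m∸n+n≡m (≤-trans (m≤n+m (a * c) a) a+ac≤P)
    closedDegSum≤bound : closedDegSum G ≤ degBound s i P M
    closedDegSum≤bound = closedDegSum≤degBound (λ v v-big → m+n≤o⇒m≤o∸n (size v) (size+ac≤P v v-big))

    coneBound-at-s : d ≤ s → ConeBound G d h
    coneBound-at-s d≤s =
      let (y , s+y≡h , bound<cone) = below-cone-at-s i<s 3≤a 3j≤c+1 M+ac≡P a+ac≤P (trans s+i+P≡n n≡h+h)
      in strictly-below d≤s s+y≡h (≤-trans (s≤s closedDegSum≤bound) bound<cone)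

    s<d⇒i≡0 : s < d → i ≡ 0
    s<d⇒i≡0 s<d with i ≤? 0
    ... | yes i≤0 = n≤0⇒n≡0 i≤0
    ... | no  i≰0 = ⊥-elim (<⇒≱ s<d (isolated⇒d≤s (≰⇒> i≰0)))

    coneBound-at-d : s < d → ConeBound G d h
    coneBound-at-d s<d =
      let (y , d+y≡h , bound<cone) = below-cone-at-d 1≤s s<d (m≤n⊔m 3 (suc d ∸ s)) 3s≤c+1 M+ac≡P a+ac≤P s+0+P≡h+h
      in strictly-below ≤-refl d+y≡h (≤-trans (s≤s closedDegSum≤bound₀) bound<cone)
      where
      i≡0 : i ≡ 0
      i≡0 = s<d⇒i≡0 s<d
      3s≤c+1 : 3 * s ≤ c + 1
      3s≤c+1 = subst (λ x → 3 * (s ∸ x) ≤ c + 1) i≡0 3j≤c+1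
      s+0+P≡h+h : s + 0 + P ≡ h + h
      s+0+P≡h+h = trans (cong (λ x → s + x + P) (sym i≡0)) (trans s+i+P≡n n≡h+h)
      closedDegSum≤bound₀ : closedDegSum G ≤ degBound s 0 P M
      closedDegSum≤bound₀ = subst (λ x → closedDegSum G ≤ degBound s x P M) i≡0 closedDegSum≤bound

  coneBound : ConeBound G d h
  coneBound with s ≤? i
  ... | yes s≤i = coneBound-if-s≤i s≤i
  ... | no  s≰i with d ≤? s
  ...   | yes d≤s = ManyOddComponents.coneBound-at-s (≰⇒> s≰i) d≤s
  ...   | no  d≰s = ManyOddComponents.coneBound-at-d (≰⇒> s≰i) (≰⇒> d≰s)

subset-count : ∀ {n} (S : Subset n) → ∣ S ∣ ≡ count (lookup S)
subset-count []          = refl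
subset-count (true ∷ S)  = cong suc (subset-count S)
subset-count (false ∷ S) = subset-count S

empty-or-inhabited : ∀ {n} (S : Subset n) → S ≡ Subset.⊥ ⊎ 1 ≤ count (lookup S)
empty-or-inhabited S with count (lookup S) in e
... | zero  = inj₁ (all-false S (count≡0⇒∀false (lookup S) e))
  where
  all-false : ∀ {n} (S : Subset n) → (∀ i → lookup S i ≡ false) → S ≡ Subset.⊥
  all-false []      _ = refl
  all-false (x ∷ S) h = cong₂ _∷_ (h zero) (all-false S (λ i → h (suc i)))
... | suc _ = inj₂ (s≤s z≤n)

barrier-inequality : ∀ {n} k (G : Graph n) S → k % 2 ≡ 1 → Barrier k G S →
  k * count (lookup S) ≤ odd# G S + k * iso# G S
barrier-inequality {n} k G S k-odd S-barrier = subst (λ m → k * m ≤ odd# G S + k * iso# G S) (subset-count S)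
  (ℤₚ.drop‿+≤+ (ℤₚ.0≤i-j⇒j≤i (ℤₚ.≤-trans 0≤φ∅ φ∅≤φS)))
  where
  φ-odd : ∀ T → phi k G T ≡ ⁺ (odd# G T + k * iso# G T) ℤ- ⁺ (k * ∣ T ∣)
  φ-odd T = cong (λ r → if r ≡ᵇ 0 then ⁺ (k * iso# G T) ℤ- ⁺ (k * ∣ T ∣)
                        else (⁺ odd# G T ℤ.+ ⁺ (k * iso# G T)) ℤ- ⁺ (k * ∣ T ∣)) k-odd
  ∣⊥∣≡0 : ∀ {n} → ∣ Subset.⊥ {n} ∣ ≡ 0
  ∣⊥∣≡0 {zero}  = refl
  ∣⊥∣≡0 {suc n} = ∣⊥∣≡0 {n}
  0≤φ∅ : ⁺ 0 ℤ≤ ⁺ (odd# G Subset.⊥ + k * iso# G Subset.⊥) ℤ- ⁺ (k * ∣ Subset.⊥ {n} ∣)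
  0≤φ∅ rewrite ∣⊥∣≡0 {n} | *-zeroʳ k = ℤ.+≤+ z≤n
  φ∅≤φS : ⁺ (odd# G Subset.⊥ + k * iso# G Subset.⊥) ℤ- ⁺ (k * ∣ Subset.⊥ {n} ∣) ℤ≤ ⁺ (odd# G S + k * iso# G S) ℤ- ⁺ (k * ∣ S ∣)
  φ∅≤φS = subst₂ _ℤ≤_ (φ-odd Subset.⊥) (φ-odd S) (S-barrier Subset.⊥)

even⇒≡half+half : ∀ {n} → n % 2 ≡ 0 → n ≡ n / 2 + n / 2
even⇒≡half+half {n} n-even = trans (m≡m%n+[m/n]*n n 2) (trans (cong (_+ n / 2 * 2) n-even) (*2≡+ (n / 2)))
  where
  *2≡+ : ∀ h → 0 + h * 2 ≡ h + h
  *2≡+ = solve-∀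

closedDegSum-cone : ∀ {n h t y} → n ≡ h + h → t + y ≡ h → closedDegSum (coneGraph n t) ≡ coneDegSum t y
closedDegSum-cone {t = t} {y} refl refl = trans (cong (λ m → closedDegSum (coneGraph m t)) (regroup t y)) (cone-closedDegSum t y)
  where
  regroup : ∀ t y → (t + y) + (t + y) ≡ t + (t + (y + y))
  regroup = solve-∀

[h+h]/2≡h : ∀ h → (h + h) / 2 ≡ h
[h+h]/2≡h h = trans (cong (_/ 2) (+-*2 h)) (m*n/n≡m h 2)
  where
  +-*2 : ∀ h → h + h ≡ h * 2
  +-*2 = solve-∀

cone≗split : ∀ {n h} → n ≡ h + h → ∀ i j → adj (coneGraph n h) i j ≡ adj (splitGraph n (n / 2)) i j
cone≗split {h = h} refl i j rewrite [h+h]/2≡h h | m+n∸m≡n h h = cong (not (i == j) ∧_) (no-clique (toℕ i <ᵇ h) (toℕ j <ᵇ h))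
  where
  no-clique : ∀ a b → (a ∨ b ∨ ((not a ∧ a) ∧ (not b ∧ b))) ∨ (b ∨ a ∨ ((not b ∧ b) ∧ (not a ∧ a))) ≡ (a ∨ b) ∨ (b ∨ a)
  no-clique true  _     = refl
  no-clique false true  = refl
  no-clique false false = refl

halve-< : ∀ {m n} → m + m < n + n → m < n
halve-< {m} {n} m+m<n+n with m <? n
... | yes m<n = m<n
... | no  m≮n = ⊥-elim (<⇒≱ m+m<n+n (+-mono-≤ (≮⇒≥ m≮n) (≮⇒≥ m≮n)))

halve-≡ : ∀ {m n} → m + m ≡ n + n → m ≡ n
halve-≡ {m} {n} e with <-cmp m n
... | tri< m<n _ _ = ⊥-elim (<-irrefl e (+-mono-< m<n m<n))
... | tri≈ _ m≡n _ = m≡n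
... | tri> _ _ n<m = ⊥-elim (<-irrefl (sym e) (+-mono-< n<m n<m))

6d+2≡ : ∀ d → 6 * d + 2 ≡ (3 * d + 1) + (3 * d + 1)
6d+2≡ = solve-∀

d≤3d+1 : ∀ d → d ≤ 3 * d + 1
d≤3d+1 d = ≤-trans (m≤m+n d (d + d + 1)) (≤-reflexive (regroup d))
  where
  regroup : ∀ d → d + (d + d + 1) ≡ 3 * d + 1
  regroup = solve-∀

module ConeComparison {n d k h} (G : Graph n) (n≡h+h : n ≡ h + h) (3≤k : 3 ≤ k) (k-odd : k % 2 ≡ 1)
  (min-deg : MinDegreeAtLeast G d) where

  GBC-if-cone-extremal : ∀ W → W ≤ closedDegSum G →
    (∀ t y → d ≤ t → t + y ≡ h → coneDegSum t y ≤ W × (coneDegSum t y ≡ W → ¬ Iso G (coneGraph n t))) →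
    GBC k G
  GBC-if-cone-extremal W W≤ extremal S S-barrier with empty-or-inhabited S
  ... | inj₁ S≡∅ = S≡∅
  ... | inj₂ 1≤s = ⊥-elim (not-cone cone≡W (tight⇒cone tight))
    where
    open ConeBound (BarrierAnalysis.coneBound G S {h = h} n≡h+h 3≤k min-deg 1≤s (barrier-inequality k G S k-odd S-barrier))
    cone≤W : coneDegSum t y ≤ W
    cone≤W = proj₁ (extremal t y d≤t t+y≡h)
    not-cone : coneDegSum t y ≡ W → ¬ Iso G (coneGraph n t)
    not-cone = proj₂ (extremal t y d≤t t+y≡h)
    tight : closedDegSum G ≡ coneDegSum t y
    tight = ≤-antisym below (≤-trans cone≤W W≤)
    cone≡W : coneDegSum t y ≡ W
    cone≡W = ≤-antisym cone≤W (≤-trans W≤ below)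

  coneDegSum≤closedDegSum : ∀ t y → t + y ≡ h → edges (coneGraph n t) ≤ edges G → coneDegSum t y ≤ closedDegSum G
  coneDegSum≤closedDegSum t y t+y≡h e≤ =
    ≤-trans (≤-reflexive (sym (closedDegSum-cone {n} {h} {t} {y} n≡h+h t+y≡h))) (closedDegSum-mono G (coneGraph n t) e≤)

  Iso-cone : ∀ {t u} → t ≡ u → Iso G (coneGraph n t) → Iso G (coneGraph n u)
  Iso-cone = subst (λ u → Iso G (coneGraph n u))

  GBC-if-3d+1<h : 3 * d + 1 < h → edges (coneGraph n d) ≤ edges G → ¬ Iso G (coneGraph n d) → GBC k G
  GBC-if-3d+1<h 3d+1<h e≤ not-cone =
    GBC-if-cone-extremal _ (coneDegSum≤closedDegSum d (h ∸ d) (m+[n∸m]≡n (≤-trans (d≤3d+1 d) (<⇒≤ 3d+1<h))) e≤)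
      λ t y d≤t t+y≡h → let (≤W , ≡W⇒t≡d) = peak-at-d 3d+1<h d≤t t+y≡h
                         in ≤W , λ eq → not-cone ∘ Iso-cone (≡W⇒t≡d eq)

  GBC-if-h≡3d+1 : h ≡ 3 * d + 1 → edges (coneGraph n d) ≤ edges G →
    ¬ Iso G (coneGraph n d) → ¬ Iso G (coneGraph n h) → GBC k G
  GBC-if-h≡3d+1 h≡3d+1 e≤ not-cone-d not-cone-h =
    GBC-if-cone-extremal _ (coneDegSum≤closedDegSum d (h ∸ d) (m+[n∸m]≡n (≤-trans (d≤3d+1 d) (≤-reflexive (sym h≡3d+1)))) e≤)
      λ t y d≤t t+y≡h → let (≤W , ≡W⇒ends) = peak-at-d-and-h h≡3d+1 d≤t t+y≡h
                         in ≤W , λ eq iso → case ≡W⇒ends eq of λ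
                              { (inj₁ t≡d) → not-cone-d (Iso-cone t≡d iso)
                              ; (inj₂ t≡h) → not-cone-h (Iso-cone t≡h iso) }

  GBC-if-h<3d+1 : h < 3 * d + 1 → edges (coneGraph n h) ≤ edges G → ¬ Iso G (coneGraph n h) → GBC k G
  GBC-if-h<3d+1 h<3d+1 e≤ not-cone =
    GBC-if-cone-extremal _ (coneDegSum≤closedDegSum h 0 (+-identityʳ h) e≤)
      λ t y d≤t t+y≡h → let (≤W , ≡W⇒t≡h) = peak-at-h h<3d+1 d≤t t+y≡h
                         in ≤W , λ eq → not-cone ∘ Iso-cone (≡W⇒t≡h eq)

corollary3p2 : (d k n : ℕ) (G : Graph n) →
    1 ≤ d → 3 ≤ k → k % 2 ≡ 1 → n % 2 ≡ 0 → 4 ≤ n →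
    Connected G → MinDegreeAtLeast G d →
    ((6 * d + 2 < n → edges (coneGraph n d) ≤ edges G →
        ¬ Iso G (coneGraph n d) → GBC k G)
    × (n ≡ 6 * d + 2 → edges (coneGraph n d) ≤ edges G →
        ¬ Iso G (coneGraph n d) → ¬ Iso G (splitGraph n (n / 2)) → GBC k G)
    × (n < 6 * d + 2 → edges (splitGraph n (n / 2)) ≤ edges G →
        ¬ Iso G (splitGraph n (n / 2)) → GBC k G))
corollary3p2 d k n G _ 3≤k k-odd n-even _ _ min-deg =
  (λ 6d+2<n → GBC-if-3d+1<h (halve-< (subst₂ _<_ (6d+2≡ d) n≡h+h 6d+2<n))) ,
  (λ n≡6d+2 e≤ not-cone not-split →
     GBC-if-h≡3d+1 (halve-≡ (trans (sym n≡h+h) (trans n≡6d+2 (6d+2≡ d)))) e≤ not-cone (not-split ∘ cone⇒split)) ,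
  (λ n<6d+2 e≤ not-split →
     GBC-if-h<3d+1 (halve-< (subst₂ _<_ n≡h+h (6d+2≡ d) n<6d+2)) (subst (_≤ edges G) split≡cone e≤) (not-split ∘ cone⇒split))
  where
  h : ℕ
  h = n / 2
  n≡h+h : n ≡ h + h
  n≡h+h = even⇒≡half+half n-even
  open ConeComparison {d = d} {k} {h} G n≡h+h 3≤k k-odd min-deg
  cone⇒split : Iso G (coneGraph n h) → Iso G (splitGraph n h)
  cone⇒split (π , π-iso) = π , λ i j → trans (π-iso i j) (cone≗split {n} {h} n≡h+h _ _)
  split≡cone : edges (splitGraph n h) ≡ edges (coneGraph n h)
  split≡cone = sumF-cong (λ i → count-cong (λ j → cong ((toℕ i <ᵇ toℕ j) ∧_) (sym (cone≗split {n} {h} n≡h+h i j))))
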